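{- Let $D=(V,A)$ be a directed acyclic graph with single source $s$ and unit-capacity arcs, and let $f:A\to\{0,1,\dots,k\}$. If $f$ has a fan-extension, then $f$ is a height function, i.e., there exist a finite field $\mathbb{F}_q$ and a linear network code $\mathbf{c}$ over $\mathbb{F}_q$ with $h_{\mathbf{c}}=f$.
   Context: Every node is assumed reachable from $s$. A linear network code of $k$ messages over $\mathbb{F}_q$ is a map $\mathbf{c}:A\to\mathbb{F}_q^k$ such that for each arc $uv$ with $u\ne s$, $\mathbf{c}(uv)$ lies in the span of $\{\mathbf{c}(wu):wu\in A\}$. The height $h_{\mathbf{c}}(a)$ is the largest index $i$ with nonzero $i$-th coordinate of $\mathbf{c}(a)$ ($0$ for the zero vector). Convention: functions $g:V\to\{0,\dots,k\}$ considered satisfy $g(s)=k$ (the source knows all layers). A path with arcs $a_1,\dots,a_r$ is monotone (w.r.t. $f$) if $f(a_1)\le\dots\le f(a_r)$; $\min(P)=f(a_1)$, $\max(P)=f(a_r)$. Given $g:V\to\{0,\dots,k\}$ and $v\ne s$, an $i$-fan of $v$ consists of $i$ pairwise arc-disjoint monotone paths $P_1,\dots,P_i$ with at least one arc each, ending at $v$, with $j\le\min(P_j)\le\max(P_j)\le i$ and $P_j$ starting at a node $v_j$ with $g(v_j)\ge\min(P_j)$, for all $j\le i$. $g$ is a fan-extension of $f$ if (i) every $v\ne s$ with $g(v)>0$ has a $g(v)$-fan, and (ii) for every arc $vw$, either $f(vw)\le g(v)$ or some arc $uv$ entering $v$ has $f(uv)=f(vw)$. -}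

module Defs where

open import Data.Nat using (ℕ; zero; suc; _≤_; _<_)
import Data.Fin as Fin
open import Data.Fin using (Fin; toℕ; fromℕ; inject₁) renaming (_≟_ to _≟F_)
open import Data.Fin.Properties using ()
open import Data.List using (List; []; _∷_; map)
open import Data.List.Membership.Propositional using (_∈_)
open import Data.List.Relation.Unary.Linked using (Linked)
open import Data.Product using (Σ; ∃; _×_; _,_)
open import Data.Sum using (_⊎_)
open import Data.Bool using (if_then_else_)
open import Data.Empty using (⊥)
open import Relation.Nullary using (¬_; Dec; yes; no; does)
open import Relation.Binary.PropositionalEquality using (_≡_; _≢_; refl; cong; sym; trans)
open import Algebra.Core using (Op₁; Op₂)
open import Algebra.Structures using (IsCommutativeRing)
open import Function.Bundles using (_↔_; Inverse)

record FiniteField : Set₁ where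
  field
    Carrier : Set
    _+_ _*_ : Op₂ Carrier
    -_      : Op₁ Carrier
    0# 1#   : Carrier
    isCommutativeRing : IsCommutativeRing _≡_ _+_ _*_ -_ 0# 1#
    0≢1     : 0# ≢ 1#
    inverse : ∀ x → x ≢ 0# → ∃ λ y → x * y ≡ 1#
    size    : ℕ
    enum    : Fin size ↔ Carrier

  _≟_ : (x y : Carrier) → Dec (x ≡ y)
  x ≟ y with Inverse.from enum x ≟F Inverse.from enum y
  ... | yes p = yes (trans (sym (Inverse.strictlyInverseˡ enum x))
                     (trans (cong (Inverse.to enum) p) (Inverse.strictlyInverseˡ enum y)))
  ... | no ¬p = no (λ q → ¬p (cong (Inverse.from enum) q))

-- Directed multigraphs: nodes Fin n, arcs Fin m (unit capacity; parallel
-- arcs are allowed and model multiplicities), each arc from tail to head.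

record Digraph (n m : ℕ) : Set where
  field
    tail head : Fin m → Fin n
open Digraph public

module _ {n m : ℕ} (G : Digraph n m) where

  data Walk : Fin n → Fin n → List (Fin m) → Set where
    []   : ∀ {u} → Walk u u []
    step : ∀ {u w a as} → tail G a ≡ u → Walk (head G a) w as → Walk u w (a ∷ as)

  Acyclic : Set
  Acyclic = ∀ v a as → ¬ Walk v v (a ∷ as)

  SingleSource : Fin n → Set
  SingleSource s = (∀ a → head G a ≢ s) × (∀ v → v ≢ s → ∃ λ a → head G a ≡ v)

  AllReachable : Fin n → Set
  AllReachable s = ∀ v → ∃ λ as → Walk s v as

  lastArc : Fin m → List (Fin m) → Fin m
  lastArc a []        = a
  lastArc a (b ∷ bs)  = lastArc b bs

  -- i-fan of v (w.r.t. f and g). Path P_j (j = 1..i) is indexed by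
  -- j' : Fin i with j = suc (toℕ j'); its arcs are first j' ∷ rest j',
  -- its start node v_j is the tail of its first arc.
  record Fan (f : Fin m → ℕ) (g : Fin n → ℕ) (i : ℕ) (v : Fin n) : Set where
    field
      first     : Fin i → Fin m
      rest      : Fin i → List (Fin m)
      isPath    : ∀ j → Walk (tail G (first j)) v (first j ∷ rest j)
      monotone  : ∀ j → Linked _≤_ (map f (first j ∷ rest j))
      lowerB    : ∀ j → suc (toℕ j) ≤ f (first j)
      minLeMax  : ∀ j → f (first j) ≤ f (lastArc (first j) (rest j))
      upperB    : ∀ j → f (lastArc (first j) (rest j)) ≤ i
      startOK   : ∀ j → f (first j) ≤ g (tail G (first j))
      disjoint  : ∀ j j' → j ≢ j' → ∀ a →
                  a ∈ (first j ∷ rest j) → a ∈ (first j' ∷ rest j') → ⊥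

  IsFanExtension : Fin n → ℕ → (Fin m → ℕ) → (Fin n → ℕ) → Set
  IsFanExtension s k f g =
    (∀ v → g v ≤ k) × (g s ≡ k) ×
    (∀ v → v ≢ s → 0 < g v → Fan f g (g v) v) ×
    (∀ b → f b ≤ g (tail G b) ⊎ ∃ λ a → head G a ≡ tail G b × f a ≡ f b)

  HasFanExtension : Fin n → ℕ → (Fin m → ℕ) → Set
  HasFanExtension s k f = ∃ λ g → IsFanExtension s k f g

module _ (F : FiniteField) where
  open FiniteField F

  sumFin : ∀ m → (Fin m → Carrier) → Carrier
  sumFin zero    h = 0#
  sumFin (suc m) h = h Fin.zero + sumFin m (λ i → h (Fin.suc i))

  -- height of a vector in F^k: largest (1-based) index with nonzero
  -- coordinate, 0 for the zero vector
  height : ∀ k → (Fin k → Carrier) → ℕ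
  height zero    x = 0
  height (suc k) x with x (fromℕ k) ≟ 0#
  ... | yes _ = height k (λ i → x (inject₁ i))
  ... | no  _ = suc k

  IsLinearNetworkCode : ∀ {n m} → Digraph n m → Fin n → (k : ℕ) →
                        (Fin m → Fin k → Carrier) → Set
  IsLinearNetworkCode {n} {m} G s k c =
    ∀ b → tail G b ≢ s →
      ∃ λ (λs : Fin m → Carrier) → ∀ (i : Fin k) →
        c b i ≡ sumFin m (λ a → if does (head G a ≟F tail G b)
                                then λs a * c a i else 0#)

IsHeightFunction : ∀ {n m} → Digraph n m → Fin n → (k : ℕ) → (Fin m → ℕ) → Set₁
IsHeightFunction {n} {m} G s k f =
  Σ FiniteField λ F →
    ∃ λ (c : Fin m → Fin k → FiniteField.Carrier F) →
      IsLinearNetworkCode F G s k c × (∀ a → height F k (c a) ≡ f a)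

-- Code the arcs greedily, in an order in which every arc comes after all arcs entering its tail,
-- over a prime field with more than n + 1 elements. For every node v ≠ s with g v > 0 fix a
-- g(v)-fan; its j-th path carries the unit vector e_j until its first arc is coded, and from then
-- on the code of its last coded arc. Invariant: these fronts form a basis of F^{g v}.
-- When an arc b leaving x is coded, the arcs entering x are all coded, so the fan of x shows that
-- e_1, ..., e_{g x} are receivable at x. The new code is chosen in the subspace W of receivable
-- vectors of height at most f b, subject to two kinds of requirements, each a linear form on W
-- that must not vanish: its f(b)-th coordinate (nonzero somewhere on W by condition (ii) of a
-- fan-extension), and, for every fan path through b, its coordinate on the front it replaces
-- (nonzero on that front, which lies in W by monotonicity of the path). By Steinitz exchange the
-- fronts stay bases, and fan paths are arc-disjoint, so there are at most n + 1 requirements;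
-- a field with more elements than that admits a vector of W meeting all of them.

module Submission where

open import Defs
open import Level using (0ℓ)
open import Data.Nat as ℕ using (ℕ; zero; suc; _∸_; _≤_; _<_; _!; NonZero; z≤n; s≤s)
import Data.Nat.Properties as ℕ
open import Data.Nat.DivMod using (_%_; _mod_; %-distribˡ-+; %-distribˡ-*; m<n⇒m%n≡m; n%n≡0; m*n%n≡0; m%n<n)
open import Data.Nat.Divisibility using (_∣_; m∣m*n; ∣m+n∣m⇒∣n; ∣1⇒≡1; m≤n⇒m!∣n!; ∣-trans)
open import Data.Nat.Primality using (Prime; prime⇒nonZero; prime⇒nonTrivial; ¬prime[0]; ¬prime[1])
open import Data.Nat.Primality.Factorisation using (factorise)
open import Data.Nat.Coprimality using (prime⇒coprime; coprime-Bézout)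
open import Data.Nat.GCD using (module Bézout)
open import Data.Fin as Fin using (Fin; toℕ; fromℕ; fromℕ<; inject₁; inject≤; punchIn) renaming (_≟_ to _≟ᶠ_)
import Data.Fin.Properties as Fin
open import Data.Vec.Functional using (Vector; updateAt)
open import Data.Vec.Functional.Properties using (updateAt-updates; updateAt-minimal)
open import Data.List using (List; []; _∷_; _++_; length; lookup; map)
open import Data.List.Properties using (length-map; length-++)
open import Data.List.Membership.Propositional using (_∈_; _∉_)
import Data.List.Membership.DecPropositional as DecMembership
open import Data.List.Relation.Unary.All using (All; []; _∷_)
import Data.List.Relation.Unary.All as All
import Data.List.Relation.Unary.All.Properties as All
open import Data.List.Relation.Unary.Any using (here; there; index)
open import Data.List.Relation.Unary.Any.Properties using (lookup-index)
open import Data.List.Relation.Unary.Linked using (Linked; []; _∷_)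
open import Data.Maybe using (Maybe; just; nothing)
open import Data.Product using (Σ; ∃; ∃₂; ∃-syntax; _×_; _,_; proj₁; proj₂)
open import Data.Sum using (_⊎_; inj₁; inj₂; fromInj₂)
open import Data.Unit using (⊤; tt)
open import Data.Bool using (true; false; if_then_else_)
open import Function.Base using (const; _∘_)
open import Function.Bundles using (_↣_; Injection; _⇔_; Equivalence; mk⇔)
open import Function.Construct.Identity using (↔-id)
open import Function.Properties.Inverse using (↔⇒↣)
open import Algebra.Structures using (IsCommutativeRing)
open import Algebra.Bundles using (Ring; CommutativeRing)
import Algebra.Properties.Ring as RingProperties
import Algebra.Properties.Semiring.Sum as SemiringSum
open import Relation.Binary.Definitions using (DecidableEquality; tri<; tri≈; tri>)
open import Relation.Binary.PropositionalEquality
open import Relation.Nullary using (¬_; Dec; yes; no; does; contradiction)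
open import Relation.Nullary.Decidable using (_×-dec_)
open import Relation.Unary using (Pred; Decidable)

-- Prime fields

module IntegersModulo (p : ℕ) .{{_ : NonZero p}} where

  ⟦_⟧ : ℕ → Fin p
  ⟦ x ⟧ = x mod p

  infixl 6 _+_
  infixl 7 _*_
  infix 8 -_

  _+_ _*_ : Fin p → Fin p → Fin p
  a + b = ⟦ toℕ a ℕ.+ toℕ b ⟧
  a * b = ⟦ toℕ a ℕ.* toℕ b ⟧

  -_ : Fin p → Fin p
  - a = ⟦ p ∸ toℕ a ⟧

  0# 1# : Fin p
  0# = ⟦ 0 ⟧
  1# = ⟦ 1 ⟧

  toℕ-⟦⟧ : ∀ x → toℕ ⟦ x ⟧ ≡ x % p
  toℕ-⟦⟧ x = Fin.toℕ-fromℕ< (m%n<n x p)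

  ⟦⟧-cong : ∀ {x y} → x % p ≡ y % p → ⟦ x ⟧ ≡ ⟦ y ⟧
  ⟦⟧-cong {x} {y} eq = Fin.toℕ-injective (trans (toℕ-⟦⟧ x) (trans eq (sym (toℕ-⟦⟧ y))))

  ⟦toℕ⟧ : ∀ a → ⟦ toℕ a ⟧ ≡ a
  ⟦toℕ⟧ a = Fin.toℕ-injective (trans (toℕ-⟦⟧ (toℕ a)) (m<n⇒m%n≡m (Fin.toℕ<n a)))

  ⟦+⟧ : ∀ x y → ⟦ x ℕ.+ y ⟧ ≡ ⟦ x ⟧ + ⟦ y ⟧
  ⟦+⟧ x y = ⟦⟧-cong (trans (%-distribˡ-+ x y p)
    (cong₂ (λ u v → (u ℕ.+ v) % p) (sym (toℕ-⟦⟧ x)) (sym (toℕ-⟦⟧ y))))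

  ⟦*⟧ : ∀ x y → ⟦ x ℕ.* y ⟧ ≡ ⟦ x ⟧ * ⟦ y ⟧
  ⟦*⟧ x y = ⟦⟧-cong (trans (%-distribˡ-* x y p)
    (cong₂ (λ u v → (u ℕ.* v) % p) (sym (toℕ-⟦⟧ x)) (sym (toℕ-⟦⟧ y))))

  ⟦p⟧ : ⟦ p ⟧ ≡ 0#
  ⟦p⟧ = ⟦⟧-cong (trans (n%n≡0 p) (sym (m<n⇒m%n≡m (ℕ.>-nonZero⁻¹ p))))

  open ≡-Reasoning

  +-assoc : ∀ a b c → (a + b) + c ≡ a + (b + c)
  +-assoc a b c = begin
    a + b + c                               ≡⟨ cong (a + b +_) (⟦toℕ⟧ c) ⟨
    ⟦ toℕ a ℕ.+ toℕ b ⟧ + ⟦ toℕ c ⟧          ≡⟨ ⟦+⟧ (toℕ a ℕ.+ toℕ b) (toℕ c) ⟨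
    ⟦ toℕ a ℕ.+ toℕ b ℕ.+ toℕ c ⟧            ≡⟨ cong ⟦_⟧ (ℕ.+-assoc (toℕ a) (toℕ b) (toℕ c)) ⟩
    ⟦ toℕ a ℕ.+ (toℕ b ℕ.+ toℕ c) ⟧          ≡⟨ ⟦+⟧ (toℕ a) (toℕ b ℕ.+ toℕ c) ⟩
    ⟦ toℕ a ⟧ + (b + c)                      ≡⟨ cong (_+ (b + c)) (⟦toℕ⟧ a) ⟩
    a + (b + c)                             ∎

  *-assoc : ∀ a b c → (a * b) * c ≡ a * (b * c)
  *-assoc a b c = begin
    a * b * c                               ≡⟨ cong (a * b *_) (⟦toℕ⟧ c) ⟨
    ⟦ toℕ a ℕ.* toℕ b ⟧ * ⟦ toℕ c ⟧          ≡⟨ ⟦*⟧ (toℕ a ℕ.* toℕ b) (toℕ c) ⟨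
    ⟦ toℕ a ℕ.* toℕ b ℕ.* toℕ c ⟧            ≡⟨ cong ⟦_⟧ (ℕ.*-assoc (toℕ a) (toℕ b) (toℕ c)) ⟩
    ⟦ toℕ a ℕ.* (toℕ b ℕ.* toℕ c) ⟧          ≡⟨ ⟦*⟧ (toℕ a) (toℕ b ℕ.* toℕ c) ⟩
    ⟦ toℕ a ⟧ * (b * c)                      ≡⟨ cong (_* (b * c)) (⟦toℕ⟧ a) ⟩
    a * (b * c)                             ∎

  +-comm : ∀ a b → a + b ≡ b + a
  +-comm a b = cong ⟦_⟧ (ℕ.+-comm (toℕ a) (toℕ b))

  *-comm : ∀ a b → a * b ≡ b * a
  *-comm a b = cong ⟦_⟧ (ℕ.*-comm (toℕ a) (toℕ b))

  +-identityˡ : ∀ a → 0# + a ≡ a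
  +-identityˡ a = begin
    0# + a              ≡⟨ cong (0# +_) (⟦toℕ⟧ a) ⟨
    ⟦ 0 ⟧ + ⟦ toℕ a ⟧   ≡⟨ ⟦+⟧ 0 (toℕ a) ⟨
    ⟦ toℕ a ⟧           ≡⟨ ⟦toℕ⟧ a ⟩
    a                   ∎

  *-identityˡ : ∀ a → 1# * a ≡ a
  *-identityˡ a = begin
    1# * a              ≡⟨ cong (1# *_) (⟦toℕ⟧ a) ⟨
    ⟦ 1 ⟧ * ⟦ toℕ a ⟧   ≡⟨ ⟦*⟧ 1 (toℕ a) ⟨
    ⟦ 1 ℕ.* toℕ a ⟧     ≡⟨ cong ⟦_⟧ (ℕ.*-identityˡ (toℕ a)) ⟩
    ⟦ toℕ a ⟧           ≡⟨ ⟦toℕ⟧ a ⟩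
    a                   ∎

  -‿inverseˡ : ∀ a → - a + a ≡ 0#
  -‿inverseˡ a = begin
    - a + a                       ≡⟨ cong (- a +_) (⟦toℕ⟧ a) ⟨
    ⟦ p ∸ toℕ a ⟧ + ⟦ toℕ a ⟧      ≡⟨ ⟦+⟧ (p ∸ toℕ a) (toℕ a) ⟨
    ⟦ p ∸ toℕ a ℕ.+ toℕ a ⟧        ≡⟨ cong ⟦_⟧ (ℕ.m∸n+n≡m (ℕ.<⇒≤ (Fin.toℕ<n a))) ⟩
    ⟦ p ⟧                         ≡⟨ ⟦p⟧ ⟩
    0#                            ∎

  *-distribˡ-+ : ∀ a b c → a * (b + c) ≡ a * b + a * c
  *-distribˡ-+ a b c = begin
    a * (b + c)                                   ≡⟨ cong (_* (b + c)) (⟦toℕ⟧ a) ⟨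
    ⟦ toℕ a ⟧ * ⟦ toℕ b ℕ.+ toℕ c ⟧                ≡⟨ ⟦*⟧ (toℕ a) (toℕ b ℕ.+ toℕ c) ⟨
    ⟦ toℕ a ℕ.* (toℕ b ℕ.+ toℕ c) ⟧                ≡⟨ cong ⟦_⟧ (ℕ.*-distribˡ-+ (toℕ a) (toℕ b) (toℕ c)) ⟩
    ⟦ toℕ a ℕ.* toℕ b ℕ.+ toℕ a ℕ.* toℕ c ⟧        ≡⟨ ⟦+⟧ (toℕ a ℕ.* toℕ b) (toℕ a ℕ.* toℕ c) ⟩
    a * b + a * c                                 ∎

  isCommutativeRing : IsCommutativeRing _≡_ _+_ _*_ -_ 0# 1#
  isCommutativeRing = record
    { isRing = record
      { +-isAbelianGroup = record
        { isGroup = record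
          { isMonoid = record
            { isSemigroup = record
              { isMagma = record { isEquivalence = isEquivalence ; ∙-cong = cong₂ _+_ }
              ; assoc = +-assoc }
            ; identity = +-identityˡ , λ a → trans (+-comm a 0#) (+-identityˡ a) }
          ; inverse = -‿inverseˡ , λ a → trans (+-comm a (- a)) (-‿inverseˡ a)
          ; ⁻¹-cong = cong -_ }
        ; comm = +-comm }
      ; *-cong = cong₂ _*_
      ; *-assoc = *-assoc
      ; *-identity = *-identityˡ , λ a → trans (*-comm a 1#) (*-identityˡ a)
      ; distrib = *-distribˡ-+
                , λ a b c → trans (*-comm (b + c) a)
                    (trans (*-distribˡ-+ a b c) (cong₂ _+_ (*-comm a b) (*-comm a c))) }
    ; *-comm = *-comm }

module _ (p : ℕ) (prime-p : Prime p) where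

  private instance
    p≢0 : NonZero p
    p≢0 = prime⇒nonZero prime-p

  open IntegersModulo p

  private
    ring : Ring _ _
    ring = record { isRing = IsCommutativeRing.isRing isCommutativeRing }

  open RingProperties ring using (-‿involutive; -‿distribʳ-*; +-inverseʳ-unique)
  open ≡-Reasoning

  private
    0≢1 : 0# ≢ 1#
    0≢1 eq = ℕ.0≢1+n (begin
      0             ≡⟨ m<n⇒m%n≡m (ℕ.>-nonZero⁻¹ p) ⟨
      0 % p         ≡⟨ toℕ-⟦⟧ 0 ⟨
      toℕ 0#        ≡⟨ cong toℕ eq ⟩
      toℕ 1#        ≡⟨ toℕ-⟦⟧ 1 ⟩
      1 % p         ≡⟨ m<n⇒m%n≡m (ℕ.nonTrivial⇒n>1 p {{prime⇒nonTrivial prime-p}}) ⟩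
      1             ∎)

    ⟦*p⟧ : ∀ x → ⟦ x ℕ.* p ⟧ ≡ 0#
    ⟦*p⟧ x = ⟦⟧-cong (trans (m*n%n≡0 x p) (sym (m<n⇒m%n≡m (ℕ.>-nonZero⁻¹ p))))

    ⟦⟧*-toℕ : ∀ y a → ⟦ y ⟧ * a ≡ ⟦ y ℕ.* toℕ a ⟧
    ⟦⟧*-toℕ y a = trans (cong (⟦ y ⟧ *_) (sym (⟦toℕ⟧ a))) (sym (⟦*⟧ y (toℕ a)))

    -- Bézout for the coprime pair (p, a) produces the inverse of a up to sign.
    inverse : ∀ a → a ≢ 0# → ∃[ b ] a * b ≡ 1#
    inverse a a≢0 with coprime-Bézout (prime⇒coprime prime-p {{toℕ-nonZero}} (Fin.toℕ<n a))
      where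
      toℕ-nonZero : NonZero (toℕ a)
      toℕ-nonZero = ℕ.≢-nonZero λ eq → a≢0 (trans (sym (⟦toℕ⟧ a)) (cong ⟦_⟧ eq))
    ... | Bézout.-+ x y eq = ⟦ y ⟧ , (begin
      a * ⟦ y ⟧                 ≡⟨ *-comm a ⟦ y ⟧ ⟩
      ⟦ y ⟧ * a                 ≡⟨ ⟦⟧*-toℕ y a ⟩
      ⟦ y ℕ.* toℕ a ⟧           ≡⟨ cong ⟦_⟧ eq ⟨
      ⟦ 1 ℕ.+ x ℕ.* p ⟧         ≡⟨ ⟦+⟧ 1 (x ℕ.* p) ⟩
      1# + ⟦ x ℕ.* p ⟧          ≡⟨ cong (1# +_) (⟦*p⟧ x) ⟩
      1# + 0#                   ≡⟨ +-comm 1# 0# ⟩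
      0# + 1#                   ≡⟨ +-identityˡ 1# ⟩
      1#                        ∎)
    ... | Bézout.+- x y eq = - ⟦ y ⟧ , (begin
      a * - ⟦ y ⟧               ≡⟨ -‿distribʳ-* a ⟦ y ⟧ ⟨
      - (a * ⟦ y ⟧)             ≡⟨ cong -_ (*-comm a ⟦ y ⟧) ⟩
      - (⟦ y ⟧ * a)             ≡⟨ cong -_ (+-inverseʳ-unique 1# (⟦ y ⟧ * a) 1+ya≡0) ⟩
      - - 1#                    ≡⟨ -‿involutive 1# ⟩
      1#                        ∎)
      where
      1+ya≡0 : 1# + ⟦ y ⟧ * a ≡ 0#
      1+ya≡0 = begin
        1# + ⟦ y ⟧ * a          ≡⟨ cong (1# +_) (⟦⟧*-toℕ y a) ⟩
        ⟦ 1 ⟧ + ⟦ y ℕ.* toℕ a ⟧ ≡⟨ ⟦+⟧ 1 (y ℕ.* toℕ a) ⟨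
        ⟦ 1 ℕ.+ y ℕ.* toℕ a ⟧   ≡⟨ cong ⟦_⟧ eq ⟩
        ⟦ x ℕ.* p ⟧             ≡⟨ ⟦*p⟧ x ⟩
        0#                      ∎

  primeField : FiniteField
  primeField = record
    { isCommutativeRing = isCommutativeRing
    ; 0≢1 = 0≢1
    ; inverse = inverse
    ; size = p
    ; enum = ↔-id (Fin p)
    }

prime∣1+n!⇒n<p : ∀ N {p} → Prime p → p ∣ suc (N !) → N < p
prime∣1+n!⇒n<p N {zero}  prime-p _      = contradiction prime-p ¬prime[0]
prime∣1+n!⇒n<p N {suc q} prime-p p∣1+N! = ℕ.≰⇒> λ p≤N → ¬prime[1] (subst Prime (∣1⇒≡1 (p∣1 p≤N)) prime-p)
  where
  p∣1 : suc q ≤ N → suc q ∣ 1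
  p∣1 p≤N = ∣m+n∣m⇒∣n (subst (suc q ∣_) (ℕ.+-comm 1 (N !)) p∣1+N!) (∣-trans (m∣m*n (q !)) (m≤n⇒m!∣n! p≤N))

∃-prime> : ∀ N → ∃[ p ] Prime p × N < p
∃-prime> N with factorise (suc (N !))
... | record { factors = [] ; isFactorisation = eq } = contradiction (sym eq) (ℕ.<⇒≢ (ℕ.s≤s (ℕ.1≤n! N)))
... | record { factors = p ∷ _ ; isFactorisation = eq ; factorsPrime = prime-p ∷ _ } =
  p , prime-p , prime∣1+n!⇒n<p N prime-p (subst (p ∣_) (sym eq) (m∣m*n _))

∃-finiteField> : ∀ N → Σ FiniteField λ F → N < FiniteField.size F
∃-finiteField> N with ∃-prime> N
... | p , prime-p , N<p = primeField p prime-p , N<p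

-- Linear algebra over a finite field

module _ {A : Set} {q} (_≟_ : DecidableEquality A) (ι : Fin q ↣ A) where

  open Injection ι using (to; injective)
  open DecMembership _≟_ using (_∈?_)

  ∃-∉ : (xs : List A) → length xs < q → ∃ λ x → All (x ≢_) xs
  ∃-∉ xs |xs|<q with Fin.all? (λ j → to j ∈? xs)
  ... | no ¬all∈ with Fin.¬∀⟶∃¬ q _ (λ j → to j ∈? xs) ¬all∈
  ...   | j , j∉xs = to j , All.¬Any⇒All¬ xs j∉xs
  ∃-∉ xs |xs|<q | yes all∈ with Fin.pigeonhole |xs|<q (λ j → index (all∈ j))
  ... | i , j , i<j , same-index = contradiction (injective (begin
        to i                            ≡⟨ lookup-index (all∈ i) ⟩
        lookup xs (index (all∈ i))      ≡⟨ cong (lookup xs) same-index ⟩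
        lookup xs (index (all∈ j))      ≡⟨ lookup-index (all∈ j) ⟨
        to j                            ∎)) (Fin.<⇒≢ i<j)
    where open ≡-Reasoning

module FieldProperties (F : FiniteField) where

  open FiniteField F public using (Carrier; 0≢1; inverse; size; enum; _≟_)

  commutativeRing : CommutativeRing 0ℓ 0ℓ
  commutativeRing = record { isCommutativeRing = FiniteField.isCommutativeRing F }

  open CommutativeRing commutativeRing public
    using ( _+_; _*_; -_; 0#; 1#; +-assoc; +-comm; +-identityˡ; +-identityʳ
          ; -‿inverseˡ; -‿inverseʳ; *-assoc; *-comm; *-identityˡ; *-identityʳ
          ; distribˡ; distribʳ; zeroˡ; zeroʳ; ring; semiring)
  open RingProperties ring public using (-1*x≈-x; x∙y⁻¹≈ε⇒x≈y; +-inverseʳ-unique)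
  open SemiringSum semiring public
    using (sum; sum-cong-≗; sum-remove; sum-replicate-zero; ∑-distrib-+; *-distribˡ-sum)

  open ≡-Reasoning

  x*y≡0⇒x≡0 : ∀ {x y} → y ≢ 0# → x * y ≡ 0# → x ≡ 0#
  x*y≡0⇒x≡0 {x} {y} y≢0 xy≡0 with inverse y y≢0
  ... | y⁻¹ , yy⁻¹≡1 = begin
    x              ≡⟨ *-identityʳ x ⟨
    x * 1#         ≡⟨ cong (x *_) yy⁻¹≡1 ⟨
    x * (y * y⁻¹)  ≡⟨ *-assoc x y y⁻¹ ⟨
    x * y * y⁻¹    ≡⟨ cong (_* y⁻¹) xy≡0 ⟩
    0# * y⁻¹       ≡⟨ zeroˡ y⁻¹ ⟩
    0#             ∎

  sumFin≡sum : ∀ m (h : Fin m → Carrier) → sumFin F m h ≡ sum h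
  sumFin≡sum zero    h = refl
  sumFin≡sum (suc m) h = cong (h Fin.zero +_) (sumFin≡sum m (h ∘ Fin.suc))

  sum-single : ∀ {i} (h : Vector Carrier i) j → (∀ j′ → j′ ≢ j → h j′ ≡ 0#) → sum h ≡ h j
  sum-single {suc i} h j h≡0 = begin
    sum h                               ≡⟨ sum-remove {i} {j} h ⟩
    h j + sum {i} (h ∘ punchIn j)       ≡⟨ cong (h j +_) (sum-cong-≗ (λ j′ → h≡0 _ (Fin.punchInᵢ≢i j j′))) ⟩
    h j + sum {i} (λ _ → 0#)            ≡⟨ cong (h j +_) (sum-replicate-zero i) ⟩
    h j + 0#                            ≡⟨ +-identityʳ (h j) ⟩
    h j                                 ∎

  -- The root of r ↦ x + r * z; an arbitrary value when z ≡ 0#, as there is no root then (for x ≢ 0#).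
  rootOf : Carrier → Carrier → Carrier
  rootOf x z with z ≟ 0#
  ... | yes _   = 0#
  ... | no z≢0  = - x * proj₁ (inverse z z≢0)

  x+r*z≢0 : ∀ {x z r} → x ≢ 0# → r ≢ rootOf x z → x + r * z ≢ 0#
  x+r*z≢0 {x} {z} {r} x≢0 r≢root x+rz≡0 with z ≟ 0#
  ... | yes z≡0 = x≢0 (begin
    x           ≡⟨ +-identityʳ x ⟨
    x + 0#      ≡⟨ cong (x +_) (trans (cong (r *_) z≡0) (zeroʳ r)) ⟨
    x + r * z   ≡⟨ x+rz≡0 ⟩
    0#          ∎)
  ... | no z≢0 with inverse z z≢0
  ...   | z⁻¹ , zz⁻¹≡1 = r≢root (begin
    r               ≡⟨ *-identityʳ r ⟨
    r * 1#          ≡⟨ cong (r *_) zz⁻¹≡1 ⟨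
    r * (z * z⁻¹)   ≡⟨ *-assoc r z z⁻¹ ⟨
    r * z * z⁻¹     ≡⟨ cong (_* z⁻¹) (+-inverseʳ-unique x (r * z) x+rz≡0) ⟩
    - x * z⁻¹       ∎)

  HeightAtMost : ∀ {k} → ℕ → Vector Carrier k → Set
  HeightAtMost h y = ∀ l → h ≤ toℕ l → y l ≡ 0#

  HasHeight : ∀ {k} → ℕ → Vector Carrier k → Set
  HasHeight h y = HeightAtMost h y × (∀ l → suc (toℕ l) ≡ h → y l ≢ 0#)

  height-HasHeight : ∀ {k h} (y : Vector Carrier k) → h ≤ k → HasHeight h y → height F k y ≡ h
  height-HasHeight {zero}  y h≤0 _ = sym (ℕ.n≤0⇒n≡0 h≤0)
  height-HasHeight {suc k} {h} y h≤1+k (y≤h , y[h-1]≢0) with y (fromℕ k) ≟ 0#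
  ... | yes y[k]≡0 = height-HasHeight (y ∘ inject₁) h≤k
        ( (λ l h≤l → y≤h (inject₁ l) (subst (h ≤_) (sym (Fin.toℕ-inject₁ l)) h≤l))
        , (λ l 1+l≡h → y[h-1]≢0 (inject₁ l) (trans (cong suc (Fin.toℕ-inject₁ l)) 1+l≡h)))
    where
    h≤k : h ≤ k
    h≤k with ℕ.m≤n⇒m<n∨m≡n h≤1+k
    ... | inj₁ h<1+k = ℕ.s≤s⁻¹ h<1+k
    ... | inj₂ refl  = contradiction y[k]≡0 (y[h-1]≢0 (fromℕ k) (cong suc (Fin.toℕ-fromℕ k)))
  ... | no y[k]≢0 with ℕ.m≤n⇒m<n∨m≡n h≤1+k
  ...   | inj₁ h<1+k = contradiction (y≤h (fromℕ k) (subst (h ≤_) (sym (Fin.toℕ-fromℕ k)) (ℕ.s≤s⁻¹ h<1+k))) y[k]≢0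
  ...   | inj₂ h≡1+k = sym h≡1+k

module CoordinateSpace (F : FiniteField) (k : ℕ) where

  open FieldProperties F
  open ≡-Reasoning

  V : Set
  V = Vector Carrier k

  infixl 6 _+ᵛ_
  infixl 7 _·ᵛ_

  0ᵛ : ∀ {n} → Vector Carrier n
  0ᵛ _ = 0#

  _+ᵛ_ : ∀ {n} → Vector Carrier n → Vector Carrier n → Vector Carrier n
  (x +ᵛ y) l = x l + y l

  _·ᵛ_ : ∀ {n} → Carrier → Vector Carrier n → Vector Carrier n
  (r ·ᵛ x) l = r * x l

  record IsSubspace (W : V → Set) : Set where
    field
      0ᵛ∈        : W 0ᵛ
      +·-closed  : ∀ {y₁ y₂} r → W y₁ → W y₂ → W (y₁ +ᵛ r ·ᵛ y₂)
      ≗-closed   : ∀ {y y′} → y ≗ y′ → W y → W y′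

  ×-isSubspace : ∀ {W W′} → IsSubspace W → IsSubspace W′ → IsSubspace (λ y → W y × W′ y)
  ×-isSubspace W W′ = record
    { 0ᵛ∈       = W.0ᵛ∈ , W′.0ᵛ∈
    ; +·-closed = λ r (w₁ , w₁′) (w₂ , w₂′) → W.+·-closed r w₁ w₂ , W′.+·-closed r w₁′ w₂′
    ; ≗-closed  = λ y≗y′ (w , w′) → W.≗-closed y≗y′ w , W′.≗-closed y≗y′ w′
    }
    where
    module W = IsSubspace W
    module W′ = IsSubspace W′

  ⊎-isSubspace : ∀ {P : Set} {W} → IsSubspace W → IsSubspace (λ y → P ⊎ W y)
  ⊎-isSubspace {P} {W} W-sub = record
    { 0ᵛ∈       = inj₂ 0ᵛ∈
    ; +·-closed = +·-closed′
    ; ≗-closed  = λ { y≗y′ (inj₁ p) → inj₁ p ; y≗y′ (inj₂ w) → inj₂ (≗-closed y≗y′ w) }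
    }
    where
    open IsSubspace W-sub
    +·-closed′ : ∀ {y₁ y₂} r → P ⊎ W y₁ → P ⊎ W y₂ → P ⊎ W (y₁ +ᵛ r ·ᵛ y₂)
    +·-closed′ r (inj₁ p)  _         = inj₁ p
    +·-closed′ r (inj₂ _)  (inj₁ p)  = inj₁ p
    +·-closed′ r (inj₂ w₁) (inj₂ w₂) = inj₂ (+·-closed r w₁ w₂)

  HeightAtMost-isSubspace : ∀ h → IsSubspace (HeightAtMost h)
  HeightAtMost-isSubspace h = record
    { 0ᵛ∈       = λ _ _ → refl
    ; +·-closed = λ {y₁} {y₂} r y₁≤h y₂≤h l h≤l → begin
        y₁ l + r * y₂ l   ≡⟨ cong₂ (λ u v → u + r * v) (y₁≤h l h≤l) (y₂≤h l h≤l) ⟩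
        0# + r * 0#       ≡⟨ +-identityˡ (r * 0#) ⟩
        r * 0#            ≡⟨ zeroʳ r ⟩
        0#                ∎
    ; ≗-closed  = λ y≗y′ y≤h l h≤l → trans (sym (y≗y′ l)) (y≤h l h≤l)
    }

  HeightAtMost-mono : ∀ {h h′} {y : V} → h ≤ h′ → HeightAtMost h y → HeightAtMost h′ y
  HeightAtMost-mono h≤h′ y≤h l h′≤l = y≤h l (ℕ.≤-trans h≤h′ h′≤l)

  lincomb : ∀ {i} → Vector Carrier i → Vector V i → V
  lincomb {i} μ Fr l = sum {i} (λ j → μ j * Fr j l)

  lincomb-cong : ∀ {i} {μ ν : Vector Carrier i} {Fr Fr′ : Vector V i} →
                 μ ≗ ν → (∀ j → Fr j ≡ Fr′ j) → lincomb μ Fr ≗ lincomb ν Fr′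
  lincomb-cong μ≗ν Fr≡Fr′ l = sum-cong-≗ (λ j → cong₂ (λ u v → u * v l) (μ≗ν j) (Fr≡Fr′ j))

  lincomb-+· : ∀ {i} (μ ν : Vector Carrier i) r Fr →
               lincomb (μ +ᵛ r ·ᵛ ν) Fr ≗ lincomb μ Fr +ᵛ r ·ᵛ lincomb ν Fr
  lincomb-+· {i} μ ν r Fr l = begin
    sum (λ j → (μ j + r * ν j) * Fr j l)            ≡⟨ sum-cong-≗ (λ j → distribʳ (Fr j l) (μ j) (r * ν j)) ⟩
    sum (λ j → μ j * Fr j l + r * ν j * Fr j l)     ≡⟨ ∑-distrib-+ (λ j → μ j * Fr j l) _ ⟩
    lincomb μ Fr l + sum (λ j → r * ν j * Fr j l)   ≡⟨ cong (lincomb μ Fr l +_)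
                                                         (sum-cong-≗ (λ j → *-assoc r (ν j) (Fr j l))) ⟩
    lincomb μ Fr l + sum (λ j → r * (ν j * Fr j l)) ≡⟨ cong (lincomb μ Fr l +_) (*-distribˡ-sum r (λ j → ν j * Fr j l)) ⟨
    lincomb μ Fr l + r * lincomb ν Fr l             ∎

  lincomb-0ᵛ : ∀ {i} (Fr : Vector V i) → lincomb 0ᵛ Fr ≗ 0ᵛ
  lincomb-0ᵛ {i} Fr l = trans (sum-cong-≗ (λ j → zeroˡ (Fr j l))) (sum-replicate-zero i)

  indicator : ∀ {i} → Fin i → Vector Carrier i
  indicator j = updateAt 0ᵛ j (const 1#)

  lincomb-indicator : ∀ {i} j (Fr : Vector V i) → lincomb (indicator j) Fr ≗ Fr j
  lincomb-indicator j Fr l = begin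
    lincomb (indicator j) Fr l   ≡⟨ sum-single (λ j′ → indicator j j′ * Fr j′ l) j (λ j′ j′≢j →
                                      trans (cong (_* Fr j′ l) (updateAt-minimal j′ j 0ᵛ j′≢j)) (zeroˡ (Fr j′ l))) ⟩
    indicator j j * Fr j l       ≡⟨ cong (_* Fr j l) (updateAt-updates j 0ᵛ) ⟩
    1# * Fr j l                  ≡⟨ *-identityˡ (Fr j l) ⟩
    Fr j l                       ∎

  lincomb-closed : ∀ {W i} → IsSubspace W → (μ : Vector Carrier i) (Fr : Vector V i) →
                   (∀ j → W (Fr j)) → W (lincomb μ Fr)
  lincomb-closed {i = zero}  W-sub μ Fr Fr∈W = IsSubspace.0ᵛ∈ W-sub
  lincomb-closed {i = suc i} W-sub μ Fr Fr∈W = ≗-closed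
    (λ l → +-comm (lincomb (μ ∘ Fin.suc) (Fr ∘ Fin.suc) l) (μ Fin.zero * Fr Fin.zero l))
    (+·-closed (μ Fin.zero) (lincomb-closed W-sub (μ ∘ Fin.suc) (Fr ∘ Fin.suc) (Fr∈W ∘ Fin.suc)) (Fr∈W Fin.zero))
    where open IsSubspace W-sub

  Independent : ∀ {i} → Vector V i → Set
  Independent Fr = ∀ μ → lincomb μ Fr ≗ 0ᵛ → μ ≗ 0ᵛ

  record IsBasisOf (W : V → Set) {i} (Fr : Vector V i) : Set where
    field
      independent : Independent Fr
      spanning    : ∀ y → W y → ∃ λ μ → y ≗ lincomb μ Fr
      ∈W          : ∀ j → W (Fr j)

  IsBasisOf-cong : ∀ {W i} {Fr Fr′ : Vector V i} → (∀ j → Fr j ≡ Fr′ j) → IsBasisOf W Fr → IsBasisOf W Fr′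
  IsBasisOf-cong {W} Fr≡Fr′ basis = record
    { independent = λ μ μFr′≗0 → independent μ (λ l → trans (lincomb-cong (λ _ → refl) Fr≡Fr′ l) (μFr′≗0 l))
    ; spanning    = λ y y∈W → let μ , y≗μFr = spanning y y∈W in
                      μ , λ l → trans (y≗μFr l) (lincomb-cong (λ _ → refl) Fr≡Fr′ l)
    ; ∈W          = λ j → subst W (Fr≡Fr′ j) (∈W j)
    }
    where open IsBasisOf basis

  independent⇒unique : ∀ {i} {Fr : Vector V i} → Independent Fr →
                       ∀ μ ν → lincomb μ Fr ≗ lincomb ν Fr → μ ≗ ν
  independent⇒unique {Fr = Fr} indep μ ν μFr≗νFr j = x∙y⁻¹≈ε⇒x≈y (μ j) (ν j) (begin
    μ j + - ν j       ≡⟨ cong (μ j +_) (-1*x≈-x (ν j)) ⟨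
    μ j + - 1# * ν j  ≡⟨ indep (μ +ᵛ - 1# ·ᵛ ν) difference≗0 j ⟩
    0#                ∎)
    where
    difference≗0 : lincomb (μ +ᵛ - 1# ·ᵛ ν) Fr ≗ 0ᵛ
    difference≗0 l = begin
      lincomb (μ +ᵛ - 1# ·ᵛ ν) Fr l             ≡⟨ lincomb-+· μ ν (- 1#) Fr l ⟩
      lincomb μ Fr l + - 1# * lincomb ν Fr l    ≡⟨ cong₂ _+_ (μFr≗νFr l) (-1*x≈-x (lincomb ν Fr l)) ⟩
      lincomb ν Fr l + - lincomb ν Fr l         ≡⟨ -‿inverseʳ (lincomb ν Fr l) ⟩
      0#                                        ∎

  unit : ℕ → V
  unit u l with toℕ l ℕ.≟ u
  ... | yes _ = 1#
  ... | no  _ = 0#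

  unit-≡ : ∀ {u l} → toℕ l ≡ u → unit u l ≡ 1#
  unit-≡ {u} {l} l≡u with toℕ l ℕ.≟ u
  ... | yes _   = refl
  ... | no l≢u  = contradiction l≡u l≢u

  unit-≢ : ∀ {u l} → toℕ l ≢ u → unit u l ≡ 0#
  unit-≢ {u} {l} l≢u with toℕ l ℕ.≟ u
  ... | yes l≡u = contradiction l≡u l≢u
  ... | no  _   = refl

  unit-HeightAtMost : ∀ {u h} → u < h → HeightAtMost h (unit u)
  unit-HeightAtMost u<h l h≤l = unit-≢ λ l≡u → ℕ.<⇒≱ u<h (subst (_ ≤_) l≡u h≤l)

  standardBasis : ∀ {i} → i ≤ k → IsBasisOf (HeightAtMost i) (λ (j : Fin i) → unit (toℕ j))
  standardBasis {i} i≤k = record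
    { independent = λ μ μE≗0 j → trans (sym (lincomb-unit μ (Fin.toℕ-inject≤ j i≤k))) (μE≗0 (inject≤ j i≤k))
    ; spanning    = λ y y∈ → (λ j → y (inject≤ j i≤k)) , spans y y∈
    ; ∈W          = λ j → unit-HeightAtMost (Fin.toℕ<n j)
    }
    where
    E : Vector V i
    E j = unit (toℕ j)

    lincomb-unit : ∀ μ {l j} → toℕ l ≡ toℕ j → lincomb μ E l ≡ μ j
    lincomb-unit μ {l} {j} l≡j = begin
      lincomb μ E l   ≡⟨ sum-single (λ j′ → μ j′ * E j′ l) j
                           (λ j′ j′≢j → trans (cong (μ j′ *_) (unit-≢ λ l≡j′ →
                              j′≢j (Fin.toℕ-injective (trans (sym l≡j′) l≡j)))) (zeroʳ (μ j′))) ⟩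
      μ j * E j l     ≡⟨ cong (μ j *_) (unit-≡ l≡j) ⟩
      μ j * 1#        ≡⟨ *-identityʳ (μ j) ⟩
      μ j             ∎

    spans : ∀ y → HeightAtMost i y → y ≗ lincomb (λ j → y (inject≤ j i≤k)) E
    spans y y∈ l with toℕ l ℕ.<? i
    ... | yes l<i = begin
      y l                            ≡⟨ cong y (Fin.toℕ-injective (trans (sym (Fin.toℕ-fromℕ< {n = i} l<i))
                                          (sym (Fin.toℕ-inject≤ (fromℕ< l<i) i≤k)))) ⟩
      y (inject≤ (fromℕ< l<i) i≤k)   ≡⟨ lincomb-unit _ {j = fromℕ< l<i} (sym (Fin.toℕ-fromℕ< l<i)) ⟨
      lincomb _ E l                  ∎
    ... | no l≮i = trans (y∈ l i≤l) (sym (lincomb-closed (HeightAtMost-isSubspace i) _ E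
                     (λ j → unit-HeightAtMost (Fin.toℕ<n j)) l i≤l))
      where i≤l = ℕ.≮⇒≥ l≮i

  lincomb-updateAt : ∀ {i} (ν : Vector Carrier i) (Fr : Vector V i) j y →
                     lincomb ν (updateAt Fr j (const y)) ≗ lincomb (updateAt ν j (const 0#)) Fr +ᵛ ν j ·ᵛ y
  lincomb-updateAt {suc i} ν Fr j y l = begin
    lincomb ν Fr′ l                                         ≡⟨ sum-remove {i} {j} (λ j′ → ν j′ * Fr′ j′ l) ⟩
    ν j * Fr′ j l + sum {i} (λ j′ → ν (pj j′) * Fr′ (pj j′) l)
      ≡⟨ cong₂ (λ u w → ν j * u l + w) (updateAt-updates j Fr)
           (sum-cong-≗ λ j′ → cong (λ u → ν (pj j′) * u l) (updateAt-minimal (pj j′) j Fr (Fin.punchInᵢ≢i j j′))) ⟩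
    ν j * y l + rest                                        ≡⟨ +-comm (ν j * y l) rest ⟩
    rest + ν j * y l                                        ≡⟨ cong (_+ ν j * y l) rest≡ ⟨
    lincomb ν₀ Fr l + ν j * y l                             ∎
    where
    Fr′ = updateAt Fr j (const y)
    ν₀ = updateAt ν j (const 0#)
    pj = punchIn j
    rest = sum {i} (λ j′ → ν (pj j′) * Fr (pj j′) l)
    rest≡ : lincomb ν₀ Fr l ≡ rest
    rest≡ = begin
      lincomb ν₀ Fr l                                       ≡⟨ sum-remove {i} {j} (λ j′ → ν₀ j′ * Fr j′ l) ⟩
      ν₀ j * Fr j l + sum {i} (λ j′ → ν₀ (pj j′) * Fr (pj j′) l)
        ≡⟨ cong₂ (λ u w → u * Fr j l + w) (updateAt-updates j ν)
             (sum-cong-≗ λ j′ → cong (_* Fr (pj j′) l) (updateAt-minimal (pj j′) j ν (Fin.punchInᵢ≢i j j′))) ⟩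
      0# * Fr j l + rest                                    ≡⟨ cong (_+ rest) (zeroˡ (Fr j l)) ⟩
      0# + rest                                             ≡⟨ +-identityˡ rest ⟩
      rest                                                  ∎

  IsBasisOf-exchange : ∀ {W i} {Fr : Vector V i} j {y} μ → IsBasisOf W Fr → W y →
                       y ≗ lincomb μ Fr → μ j ≢ 0# → IsBasisOf W (updateAt Fr j (const y))
  IsBasisOf-exchange {W} {i} {Fr} j {y} μ basis y∈W y≗μFr μj≢0 = record
    { independent = independent′ ; spanning = spanning′ ; ∈W = ∈W′ }
    where
    open IsBasisOf basis
    Fr′ = updateAt Fr j (const y)

    expand : Vector Carrier i → Vector Carrier i
    expand ν = updateAt ν j (const 0#) +ᵛ ν j ·ᵛ μ

    lincomb-expand : ∀ ν → lincomb ν Fr′ ≗ lincomb (expand ν) Fr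
    lincomb-expand ν l = begin
      lincomb ν Fr′ l                         ≡⟨ lincomb-updateAt ν Fr j y l ⟩
      lincomb ν₀ Fr l + ν j * y l             ≡⟨ cong (λ u → lincomb ν₀ Fr l + ν j * u) (y≗μFr l) ⟩
      lincomb ν₀ Fr l + ν j * lincomb μ Fr l  ≡⟨ lincomb-+· ν₀ μ (ν j) Fr l ⟨
      lincomb (expand ν) Fr l                 ∎
      where ν₀ = updateAt ν j (const 0#)

    independent′ : Independent Fr′
    independent′ ν νFr′≗0 = ν≗0
      where
      expand≗0 : expand ν ≗ 0ᵛ
      expand≗0 = independent (expand ν) (λ l → trans (sym (lincomb-expand ν l)) (νFr′≗0 l))

      νj≡0 : ν j ≡ 0#
      νj≡0 = x*y≡0⇒x≡0 μj≢0 (begin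
        ν j * μ j        ≡⟨ +-identityˡ (ν j * μ j) ⟨
        0# + ν j * μ j   ≡⟨ cong (_+ ν j * μ j) (updateAt-updates j ν) ⟨
        expand ν j       ≡⟨ expand≗0 j ⟩
        0#               ∎)

      ν≗0 : ν ≗ 0ᵛ
      ν≗0 j′ with j′ ≟ᶠ j
      ... | yes refl = νj≡0
      ... | no j′≢j  = begin
        ν j′                ≡⟨ +-identityʳ (ν j′) ⟨
        ν j′ + 0#           ≡⟨ cong (ν j′ +_) (zeroˡ (μ j′)) ⟨
        ν j′ + 0# * μ j′    ≡⟨ cong₂ (λ u v → u + v * μ j′) (updateAt-minimal j′ j ν j′≢j) νj≡0 ⟨
        expand ν j′         ≡⟨ expand≗0 j′ ⟩
        0#                  ∎

    spanning′ : ∀ w → W w → ∃ λ ν → w ≗ lincomb ν Fr′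
    spanning′ w w∈W with spanning w w∈W | inverse (μ j) μj≢0
    ... | κ , w≗κFr | μj⁻¹ , μjμj⁻¹≡1 =
      ν , λ l → trans (w≗κFr l)
                (trans (lincomb-cong {Fr = Fr} (sym ∘ expand-ν) (λ _ → refl) l) (sym (lincomb-expand ν l)))
      where
      c = κ j * μj⁻¹
      ν = updateAt (κ +ᵛ (- c) ·ᵛ μ) j (const c)

      expand-ν : expand ν ≗ κ
      expand-ν j′ with j′ ≟ᶠ j
      ... | yes refl = begin
        updateAt ν j (const 0#) j + ν j * μ j   ≡⟨ cong₂ (λ u v → u + v * μ j)
                                                     (updateAt-updates j ν) (updateAt-updates j _) ⟩
        0# + c * μ j                            ≡⟨ +-identityˡ (c * μ j) ⟩
        κ j * μj⁻¹ * μ j                        ≡⟨ *-assoc (κ j) μj⁻¹ (μ j) ⟩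
        κ j * (μj⁻¹ * μ j)                      ≡⟨ cong (κ j *_) (trans (*-comm μj⁻¹ (μ j)) μjμj⁻¹≡1) ⟩
        κ j * 1#                                ≡⟨ *-identityʳ (κ j) ⟩
        κ j                                     ∎
      ... | no j′≢j = begin
        updateAt ν j (const 0#) j′ + ν j * μ j′ ≡⟨ cong₂ (λ u v → u + v * μ j′)
                                                     (trans (updateAt-minimal j′ j ν j′≢j) (updateAt-minimal j′ j _ j′≢j))
                                                     (updateAt-updates j _) ⟩
        κ j′ + - c * μ j′ + c * μ j′            ≡⟨ +-assoc (κ j′) (- c * μ j′) (c * μ j′) ⟩
        κ j′ + (- c * μ j′ + c * μ j′)          ≡⟨ cong (κ j′ +_) (distribʳ (μ j′) (- c) c) ⟨
        κ j′ + (- c + c) * μ j′                 ≡⟨ cong (λ u → κ j′ + u * μ j′) (-‿inverseˡ c) ⟩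
        κ j′ + 0# * μ j′                        ≡⟨ cong (κ j′ +_) (zeroˡ (μ j′)) ⟩
        κ j′ + 0#                               ≡⟨ +-identityʳ (κ j′) ⟩
        κ j′                                    ∎

    ∈W′ : ∀ j′ → W (Fr′ j′)
    ∈W′ j′ with j′ ≟ᶠ j
    ... | yes refl = subst W (sym (updateAt-updates j Fr)) y∈W
    ... | no j′≢j  = subst W (sym (updateAt-minimal j′ j Fr j′≢j)) (∈W j′)

  module Coordinates {i} {Fr : Vector V i} (basis : IsBasisOf (HeightAtMost i) Fr) where

    open IsBasisOf basis

    truncate : V → V
    truncate y l with toℕ l ℕ.<? i
    ... | yes _ = y l
    ... | no  _ = 0#

    truncate-HeightAtMost : ∀ y → HeightAtMost i (truncate y)
    truncate-HeightAtMost y l i≤l with toℕ l ℕ.<? i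
    ... | yes l<i = contradiction l<i (ℕ.≤⇒≯ i≤l)
    ... | no  _   = refl

    truncate-id : ∀ {y} → HeightAtMost i y → truncate y ≗ y
    truncate-id {y} y∈ l with toℕ l ℕ.<? i
    ... | yes _   = refl
    ... | no  l≮i = sym (y∈ l (ℕ.≮⇒≥ l≮i))

    -- Truncating first makes the coordinate map a total function on V.
    coord : V → Vector Carrier i
    coord y = proj₁ (spanning (truncate y) (truncate-HeightAtMost y))

    coord-spec : ∀ {y} → HeightAtMost i y → y ≗ lincomb (coord y) Fr
    coord-spec {y} y∈ l = trans (sym (truncate-id y∈ l)) (proj₂ (spanning (truncate y) (truncate-HeightAtMost y)) l)

    coord-unique : ∀ {y} μ → HeightAtMost i y → y ≗ lincomb μ Fr → coord y ≗ μ
    coord-unique μ y∈ y≗μFr = independent⇒unique independent _ μ (λ l → trans (sym (coord-spec y∈ l)) (y≗μFr l))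

    coord-+· : ∀ {y₁ y₂} r → HeightAtMost i y₁ → HeightAtMost i y₂ →
               coord (y₁ +ᵛ r ·ᵛ y₂) ≗ coord y₁ +ᵛ r ·ᵛ coord y₂
    coord-+· {y₁} {y₂} r y₁∈ y₂∈ =
      coord-unique _ (IsSubspace.+·-closed (HeightAtMost-isSubspace i) r y₁∈ y₂∈) λ l →
        trans (cong₂ (λ u v → u + r * v) (coord-spec y₁∈ l) (coord-spec y₂∈ l))
              (sym (lincomb-+· (coord y₁) (coord y₂) r Fr l))

    coord-basisVector : ∀ j → coord (Fr j) j ≡ 1#
    coord-basisVector j = trans (coord-unique (indicator j) (∈W j) (sym ∘ lincomb-indicator j Fr) j)
                                (updateAt-updates j 0ᵛ)

  record NonzeroFormOn (W : V → Set) : Set where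
    field
      form      : V → Carrier
      +·-linear : ∀ {y₁ y₂} r → W y₁ → W y₂ → form (y₁ +ᵛ r ·ᵛ y₂) ≡ form y₁ + r * form y₂
      witness   : V
      witness∈W : W witness
      witness≢0 : form witness ≢ 0#

  open NonzeroFormOn

  Avoids : ∀ {W} → V → List (NonzeroFormOn W) → Set
  Avoids y φs = All (λ φ → form φ y ≢ 0#) φs

  -- If the point found for the other forms is a zero of φ, step from it along the witness of φ:
  -- every other form vanishes for at most one step size, and the field has more elements than that.
  ∃-avoiding : ∀ {W} → IsSubspace W → (φs : List (NonzeroFormOn W)) → length φs < size →
               ∃ λ y → W y × Avoids y φs
  ∃-avoiding W-sub [] _ = 0ᵛ , IsSubspace.0ᵛ∈ W-sub , []
  ∃-avoiding {W} W-sub (φ ∷ φs) |φφs|<q with ∃-avoiding W-sub φs (ℕ.<-trans (ℕ.n<1+n _) |φφs|<q)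
  ... | y , y∈W , y-avoids with form φ y ≟ 0#
  ...   | no φy≢0 = y , y∈W , φy≢0 ∷ y-avoids
  ...   | yes φy≡0 = y +ᵛ r ·ᵛ a , +·-closed r y∈W a∈W , φ-avoided ∷ φs-avoided
    where
    open IsSubspace W-sub
    a = witness φ
    a∈W = witness∈W φ
    bad : List Carrier
    bad = 0# ∷ map (λ ψ → rootOf (form ψ y) (form ψ a)) φs
    fresh = ∃-∉ _≟_ (↔⇒↣ enum) bad (subst (λ len → suc len < size) (sym (length-map _ φs)) |φφs|<q)
    r = proj₁ fresh
    r≢0 : r ≢ 0#
    r≢0 with proj₂ fresh
    ... | r≢0 ∷ _ = r≢0
    r≢roots : All (λ ψ → r ≢ rootOf (form ψ y) (form ψ a)) φs
    r≢roots with proj₂ fresh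
    ... | _ ∷ r∉ = All.map⁻ r∉
    φ-avoided : form φ (y +ᵛ r ·ᵛ a) ≢ 0#
    φ-avoided φ[y+ra]≡0 = witness≢0 φ (x*y≡0⇒x≡0 r≢0 (begin
      form φ a * r              ≡⟨ *-comm (form φ a) r ⟩
      r * form φ a              ≡⟨ +-identityˡ (r * form φ a) ⟨
      0# + r * form φ a         ≡⟨ cong (_+ r * form φ a) φy≡0 ⟨
      form φ y + r * form φ a   ≡⟨ +·-linear φ r y∈W a∈W ⟨
      form φ (y +ᵛ r ·ᵛ a)      ≡⟨ φ[y+ra]≡0 ⟩
      0#                        ∎))
    φs-avoided : Avoids (y +ᵛ r ·ᵛ a) φs
    φs-avoided = All.zipWith
      (λ { {ψ} (ψy≢0 , r≢root) → x+r*z≢0 ψy≢0 r≢root ∘ trans (sym (+·-linear ψ r y∈W a∈W)) })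
      (y-avoids , r≢roots)

  record Requirement (W : V → Set) (N : ℕ) (P : V → Set) : Set where
    field
      forms      : List (NonzeroFormOn W)
      few        : length forms ≤ N
      sufficient : ∀ {y} → W y → Avoids y forms → P y

  module _ {W : V → Set} where

    trivialRequirement : ∀ {N P} → (∀ {y} → W y → P y) → Requirement W N P
    trivialRequirement P-holds = record { forms = [] ; few = z≤n ; sufficient = λ y∈W _ → P-holds y∈W }

    singleRequirement : ∀ {P} (φ : NonzeroFormOn W) → (∀ {y} → W y → form φ y ≢ 0# → P y) → Requirement W 1 P
    singleRequirement φ φ-suffices = record
      { forms = φ ∷ [] ; few = ℕ.≤-refl ; sufficient = λ { y∈W (φy≢0 ∷ []) → φ-suffices y∈W φy≢0 } }

    ×-Requirement : ∀ {N M P Q} → Requirement W N P → Requirement W M Q → Requirement W (N ℕ.+ M) (λ y → P y × Q y)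
    ×-Requirement R S = record
      { forms      = R.forms ++ S.forms
      ; few        = subst (_≤ _) (sym (length-++ R.forms)) (ℕ.+-mono-≤ R.few S.few)
      ; sufficient = λ y∈W avoids →
          R.sufficient y∈W (All.++⁻ˡ R.forms avoids) , S.sufficient y∈W (All.++⁻ʳ R.forms avoids)
      }
      where
      module R = Requirement R
      module S = Requirement S

    Π-Requirement : ∀ {n N} {P : Fin n → V → Set} → (∀ v → Requirement W N (P v)) →
                    Requirement W (n ℕ.* N) (λ y → ∀ v → P v y)
    Π-Requirement {zero}  R = trivialRequirement λ _ ()
    Π-Requirement {suc n} {P = P} R = record
      { forms = R′.forms ; few = R′.few ; sufficient = λ y∈W avoids → all-v (R′.sufficient y∈W avoids) }
      where
      module R′ = Requirement (×-Requirement (R Fin.zero) (Π-Requirement (R ∘ Fin.suc)))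
      all-v : ∀ {y} → P Fin.zero y × (∀ v → P (Fin.suc v) y) → ∀ v → P v y
      all-v (p₀ , _)  Fin.zero    = p₀
      all-v (_ , pₛ) (Fin.suc v) = pₛ v

    Requirement-satisfiable : ∀ {N P} → IsSubspace W → Requirement W N P → N < size → ∃ λ y → W y × P y
    Requirement-satisfiable W-sub R N<q
      with ∃-avoiding W-sub (Requirement.forms R) (ℕ.≤-<-trans (Requirement.few R) N<q)
    ... | y , y∈W , avoids = y , y∈W , Requirement.sufficient R y∈W avoids

-- Ranking the arcs of an acyclic digraph

module _ {p} {P : Pred ℕ p} (P? : Decidable P) where

  greatest≤ : ℕ → ℕ
  greatest≤ zero = zero
  greatest≤ (suc N) with P? (suc N)
  ... | yes _ = suc N
  ... | no  _ = greatest≤ N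

  greatest≤-satisfies : P 0 → ∀ N → P (greatest≤ N)
  greatest≤-satisfies P0 zero = P0
  greatest≤-satisfies P0 (suc N) with P? (suc N)
  ... | yes P[1+N] = P[1+N]
  ... | no  _      = greatest≤-satisfies P0 N

  greatest≤-maximal : ∀ N {t} → t ≤ N → P t → t ≤ greatest≤ N
  greatest≤-maximal zero    t≤0   _  = t≤0
  greatest≤-maximal (suc N) t≤1+N Pt with P? (suc N)
  ... | yes _     = t≤1+N
  ... | no  ¬P[1+N] with ℕ.m≤n⇒m<n∨m≡n t≤1+N
  ...   | inj₁ t<1+N = greatest≤-maximal N (ℕ.s≤s⁻¹ t<1+N) Pt
  ...   | inj₂ refl  = contradiction Pt ¬P[1+N]

  greatest≤-≤ : ∀ N → greatest≤ N ≤ N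
  greatest≤-≤ zero = z≤n
  greatest≤-≤ (suc N) with P? (suc N)
  ... | yes _ = ℕ.≤-refl
  ... | no  _ = ℕ.m≤n⇒m≤1+n (greatest≤-≤ N)

module _ {n m : ℕ} (G : Digraph n m) where

  walk-prefix : ∀ {u w as a} → Walk G u w as → a ∈ as → ∃ λ bs → Walk G u (tail G a) bs
  walk-prefix (step refl _) (here refl) = [] , []
  walk-prefix (step e p) (there a∈as) with walk-prefix p a∈as
  ... | bs , q = _ ∷ bs , step e q

  walk-suffix : ∀ {u w as a} → Walk G u w as → a ∈ as → ∃ λ bs → Walk G (head G a) w bs
  walk-suffix (step _ p) (here refl)  = _ , p
  walk-suffix (step _ p) (there a∈as) = walk-suffix p a∈as

  lastArc-head : ∀ {u w a as} → Walk G u w (a ∷ as) → head G (lastArc G a as) ≡ w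
  lastArc-head (step _ [])         = refl
  lastArc-head (step _ (step e p)) = lastArc-head (step e p)

  visited : ∀ {u w as} → Walk G u w as → Fin (suc (length as)) → Fin n
  visited {u} []         _           = u
  visited {u} (step _ _) Fin.zero    = u
  visited     (step _ p) (Fin.suc i) = visited p i

  walk-to-visited : ∀ {u w as} (p : Walk G u w as) i → ∃ λ bs → Walk G u (visited p i) bs
  walk-to-visited []         Fin.zero    = [] , []
  walk-to-visited (step _ _) Fin.zero    = [] , []
  walk-to-visited (step e p) (Fin.suc i) with walk-to-visited p i
  ... | bs , q = _ ∷ bs , step e q

  walk-between-visited : ∀ {u w as} (p : Walk G u w as) i j → toℕ i < toℕ j →
                         ∃₂ λ b bs → Walk G (visited p i) (visited p j) (b ∷ bs)
  walk-between-visited (step e p) Fin.zero    (Fin.suc j) _ with walk-to-visited p j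
  ... | bs , q = _ , bs , step e q
  walk-between-visited (step e p) (Fin.suc i) (Fin.suc j) i<j = walk-between-visited p i j (ℕ.s<s⁻¹ i<j)

  -- A walk with n arcs visits n + 1 nodes, so some node twice, which closes a cycle.
  walk-length<n : Acyclic G → ∀ {u w as} → Walk G u w as → length as < n
  walk-length<n acyclic {as = as} p with length as ℕ.<? n
  ... | yes |as|<n = |as|<n
  ... | no  |as|≮n with Fin.pigeonhole (s≤s (ℕ.≮⇒≥ |as|≮n)) (visited p)
  ...   | i , j , i<j , same with walk-between-visited p i j i<j
  ...     | b , bs , cycle = contradiction (subst (λ v → Walk G v (visited p j) (b ∷ bs)) same cycle) (acyclic _ b bs)

module ArcRank {n m : ℕ} (G : Digraph n m) (acyclic : Acyclic G) where

  WalkFrom : ℕ → Fin n → Set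
  WalkFrom zero    v = ⊤
  WalkFrom (suc t) v = ∃ λ a → tail G a ≡ v × WalkFrom t (head G a)

  walkFrom? : ∀ t v → Dec (WalkFrom t v)
  walkFrom? zero    v = yes tt
  walkFrom? (suc t) v = Fin.any? (λ a → (tail G a ≟ᶠ v) ×-dec walkFrom? t (head G a))

  WalkFrom⇒Walk : ∀ t {v} → WalkFrom t v → ∃₂ λ w as → Walk G v w as × length as ≡ t
  WalkFrom⇒Walk zero    _                     = _ , [] , [] , refl
  WalkFrom⇒Walk (suc t) (a , refl , walkFrom) with WalkFrom⇒Walk t walkFrom
  ... | w , as , p , refl = w , a ∷ as , step refl p , refl

  WalkFrom⇒<n : ∀ {t v} → WalkFrom t v → t < n
  WalkFrom⇒<n {t} walkFrom with WalkFrom⇒Walk t walkFrom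
  ... | _ , _ , p , refl = walk-length<n G acyclic p

  -- The length of a longest walk starting at v.
  depth : Fin n → ℕ
  depth v = greatest≤ (λ t → walkFrom? t v) n

  depth-arc : ∀ a → depth (head G a) < depth (tail G a)
  depth-arc a = greatest≤-maximal (λ t → walkFrom? t (tail G a)) n (ℕ.<⇒≤ (WalkFrom⇒<n longer)) longer
    where
    longer : WalkFrom (suc (depth (head G a))) (tail G a)
    longer = a , refl , greatest≤-satisfies (λ t → walkFrom? t (head G a)) tt n

  depth-walk : ∀ {u w as} → Walk G u w as → depth w ≤ depth u
  depth-walk []                   = ℕ.≤-refl
  depth-walk (step {a = a} refl p) = ℕ.≤-trans (depth-walk p) (ℕ.<⇒≤ (depth-arc a))

  -- Arcs are ordered by decreasing depth of their tails, ties broken by index.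
  rank : Fin m → ℕ
  rank a = (n ∸ depth (tail G a)) ℕ.* m ℕ.+ toℕ a

  private
    depth≤n : ∀ v → depth v ≤ n
    depth≤n v = greatest≤-≤ (λ t → walkFrom? t v) n

    rank<next : ∀ a → rank a < suc (n ∸ depth (tail G a)) ℕ.* m
    rank<next a = begin-strict
      (n ∸ depth (tail G a)) ℕ.* m ℕ.+ toℕ a   <⟨ ℕ.+-monoʳ-< _ (Fin.toℕ<n a) ⟩
      (n ∸ depth (tail G a)) ℕ.* m ℕ.+ m     ≡⟨ ℕ.+-comm _ m ⟩
      suc (n ∸ depth (tail G a)) ℕ.* m       ∎
      where open ℕ.≤-Reasoning

  rank-< : ∀ {a b} → depth (tail G b) < depth (tail G a) → rank a < rank b
  rank-< {a} {b} deeper = begin-strict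
    rank a                               <⟨ rank<next a ⟩
    suc (n ∸ depth (tail G a)) ℕ.* m       ≤⟨ ℕ.*-monoˡ-≤ m (ℕ.∸-monoʳ-< deeper (depth≤n (tail G a))) ⟩
    (n ∸ depth (tail G b)) ℕ.* m           ≤⟨ ℕ.m≤m+n _ (toℕ b) ⟩
    rank b                               ∎
    where open ℕ.≤-Reasoning

  rank-injective : ∀ {a b} → rank a ≡ rank b → a ≡ b
  rank-injective {a} {b} eq with ℕ.<-cmp (depth (tail G a)) (depth (tail G b))
  ... | tri< a<b _ _ = contradiction (sym eq) (ℕ.<⇒≢ (rank-< a<b))
  ... | tri> _ _ b<a = contradiction eq (ℕ.<⇒≢ (rank-< b<a))
  ... | tri≈ _ same _ = Fin.toℕ-injective (ℕ.+-cancelˡ-≡ _ (toℕ a) (toℕ b)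
                          (trans eq (cong (λ d → (n ∸ d) ℕ.* m ℕ.+ toℕ b) (sym same))))

  rank<bound : ∀ a → rank a < suc n ℕ.* m
  rank<bound a = ℕ.<-≤-trans (rank<next a) (ℕ.*-monoˡ-≤ m (s≤s (ℕ.m∸n≤m n (depth (tail G a)))))

  rank-<-walk : ∀ {a b as} → Walk G (head G a) (tail G b) as → rank a < rank b
  rank-<-walk {a} p = rank-< (ℕ.≤-<-trans (depth-walk p) (depth-arc a))

  rank-later : ∀ {u w a as a′} → Walk G u w (a ∷ as) → a′ ∈ as → rank a < rank a′
  rank-later (step _ p) a′∈as with walk-prefix G p a′∈as
  ... | _ , q = rank-<-walk q

  rank-before-end : ∀ {u as a b} → Walk G u (tail G b) as → a ∈ as → rank a < rank b
  rank-before-end p a∈as with walk-suffix G p a∈as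
  ... | _ , q = rank-<-walk q

  rank-arc : ∀ {a b} → head G a ≡ tail G b → rank a < rank b
  rank-arc {a} a→b = rank-<-walk (subst (λ v → Walk G (head G a) v []) a→b [])

-- The greedy construction

module _ {n m} (G : Digraph n m) (f : Fin m → ℕ) where

  Linked-head≤ : ∀ {a as a′} → Linked _≤_ (map f (a ∷ as)) → a′ ∈ a ∷ as → f a ≤ f a′
  Linked-head≤ _                        (here refl)  = ℕ.≤-refl
  Linked-head≤ {as = _ ∷ _} (a≤ ∷ linked) (there a′∈) = ℕ.≤-trans a≤ (Linked-head≤ linked a′∈)

  Linked-≤last : ∀ {a as a′} → Linked _≤_ (map f (a ∷ as)) → a′ ∈ a ∷ as → f a′ ≤ f (lastArc G a as)
  Linked-≤last {as = []}    _             (here refl)  = ℕ.≤-refl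
  Linked-≤last {as = _ ∷ _} (a≤ ∷ linked) (here refl)  = ℕ.≤-trans a≤ (Linked-≤last linked (here refl))
  Linked-≤last {as = _ ∷ _} (_ ∷ linked)  (there a′∈) = Linked-≤last linked a′∈

  Linked-tail : ∀ {a as} → Linked _≤_ (map f (a ∷ as)) → Linked _≤_ (map f as)
  Linked-tail {as = []}    _           = []
  Linked-tail {as = _ ∷ _} (_ ∷ linked) = linked

module GreedyCode {n m : ℕ} (G : Digraph n m) (s : Fin n) (k : ℕ) (f : Fin m → ℕ) (g : Fin n → ℕ)
  (acyclic : Acyclic G) (f≤k : ∀ a → f a ≤ k) (fanExtension : IsFanExtension G s k f g)
  (F : FiniteField) where

  open FieldProperties F
  open CoordinateSpace F k
  open ArcRank G acyclic
  open DecMembership (_≟ᶠ_ {m}) using (_∈?_)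
  open ≡-Reasoning

  Code : Set
  Code = Fin m → V

  -- Verbatim the span condition of IsLinearNetworkCode; SpannedAt⁺ and SpannedAt⁻ restate it with lincomb.
  SpannedAt : Code → Fin n → V → Set
  SpannedAt c x y = ∃ λ (λs : Fin m → Carrier) → ∀ i →
    y i ≡ sumFin F m (λ a → if does (head G a ≟ᶠ x) then λs a * c a i else 0#)

  onEntering : Fin n → Vector Carrier m → Vector Carrier m
  onEntering x λs a = if does (head G a ≟ᶠ x) then λs a else 0#

  sumFin-entering : ∀ c x λs i →
    sumFin F m (λ a → if does (head G a ≟ᶠ x) then λs a * c a i else 0#) ≡ lincomb (onEntering x λs) c i
  sumFin-entering c x λs i = trans (sumFin≡sum m _) (sum-cong-≗ term)
    where
    term : ∀ a → (if does (head G a ≟ᶠ x) then λs a * c a i else 0#) ≡ onEntering x λs a * c a i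
    term a with does (head G a ≟ᶠ x)
    ... | true  = refl
    ... | false = sym (zeroˡ (c a i))

  SpannedAt⁺ : ∀ {c x y} λs → y ≗ lincomb (onEntering x λs) c → SpannedAt c x y
  SpannedAt⁺ {c} {x} λs y≗ = λs , λ i → trans (y≗ i) (sym (sumFin-entering c x λs i))

  SpannedAt⁻ : ∀ {c x y} → SpannedAt c x y → ∃ λ λs → y ≗ lincomb (onEntering x λs) c
  SpannedAt⁻ {c} {x} (λs , y≡) = λs , λ i → trans (y≡ i) (sumFin-entering c x λs i)

  SpannedAt-isSubspace : ∀ c x → IsSubspace (SpannedAt c x)
  SpannedAt-isSubspace c x = record
    { 0ᵛ∈       = SpannedAt⁺ 0ᵛ λ i →
                    sym (trans (lincomb-cong {Fr = c} onEntering-0ᵛ (λ _ → refl) i) (lincomb-0ᵛ c i))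
    ; +·-closed = +·-closed
    ; ≗-closed  = λ y≗y′ y∈ → let λs , y≗ = SpannedAt⁻ y∈ in SpannedAt⁺ λs (λ i → trans (sym (y≗y′ i)) (y≗ i))
    }
    where
    onEntering-0ᵛ : onEntering x 0ᵛ ≗ 0ᵛ
    onEntering-0ᵛ a with does (head G a ≟ᶠ x)
    ... | true  = refl
    ... | false = refl

    onEntering-+· : ∀ λs₁ λs₂ r →
                    onEntering x (λs₁ +ᵛ r ·ᵛ λs₂) ≗ onEntering x λs₁ +ᵛ r ·ᵛ onEntering x λs₂
    onEntering-+· λs₁ λs₂ r a with does (head G a ≟ᶠ x)
    ... | true  = refl
    ... | false = sym (trans (+-identityˡ (r * 0#)) (zeroʳ r))

    +·-closed : ∀ {y₁ y₂} r → SpannedAt c x y₁ → SpannedAt c x y₂ → SpannedAt c x (y₁ +ᵛ r ·ᵛ y₂)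
    +·-closed {y₁} {y₂} r y₁∈ y₂∈ with SpannedAt⁻ y₁∈ | SpannedAt⁻ y₂∈
    ... | λs₁ , y₁≗ | λs₂ , y₂≗ = SpannedAt⁺ (λs₁ +ᵛ r ·ᵛ λs₂) λ i → begin
      y₁ i + r * y₂ i                                             ≡⟨ cong₂ (λ u v → u + r * v) (y₁≗ i) (y₂≗ i) ⟩
      lincomb (onEntering x λs₁) c i + r * lincomb (onEntering x λs₂) c i
                                                                  ≡⟨ lincomb-+· (onEntering x λs₁) (onEntering x λs₂) r c i ⟨
      lincomb (onEntering x λs₁ +ᵛ r ·ᵛ onEntering x λs₂) c i     ≡⟨ lincomb-cong {Fr = c}
                                                                       (sym ∘ onEntering-+· λs₁ λs₂ r) (λ _ → refl) i ⟩
      lincomb (onEntering x (λs₁ +ᵛ r ·ᵛ λs₂)) c i                ∎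

  SpannedAt-entering : ∀ c {x} a → head G a ≡ x → SpannedAt c x (c a)
  SpannedAt-entering c {x} a a→x = SpannedAt⁺ (indicator a) λ i →
    sym (trans (lincomb-cong {Fr = c} onEntering-indicator (λ _ → refl) i) (lincomb-indicator a c i))
    where
    onEntering-indicator : onEntering x (indicator a) ≗ indicator a
    onEntering-indicator a′ with head G a′ ≟ᶠ x
    ... | yes _ = refl
    ... | no a′↛x with a′ ≟ᶠ a
    ...   | yes refl = contradiction a→x a′↛x
    ...   | no a′≢a  = sym (updateAt-minimal a′ a 0ᵛ a′≢a)

  SpannedAt-local : ∀ {c c′ x y} → (∀ a → head G a ≡ x → c a ≡ c′ a) → SpannedAt c x y → SpannedAt c′ x y
  SpannedAt-local {c} {c′} {x} same y∈ with SpannedAt⁻ y∈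
  ... | λs , y≗ = SpannedAt⁺ λs λ i → trans (y≗ i) (sum-cong-≗ (term i))
    where
    term : ∀ i a → onEntering x λs a * c a i ≡ onEntering x λs a * c′ a i
    term i a with head G a ≟ᶠ x
    ... | yes a→x = cong (λ v → λs a * v i) (same a a→x)
    ... | no  _   = trans (zeroˡ (c a i)) (sym (zeroˡ (c′ a i)))

  Available : Code → Fin n → V → Set
  Available c x y = x ≡ s ⊎ SpannedAt c x y

  Available-isSubspace : ∀ c x → IsSubspace (Available c x)
  Available-isSubspace c x = ⊎-isSubspace (SpannedAt-isSubspace c x)

  -- The code of the last arc of L before its first arc of rank ≥ t, or x if there is none.
  front : Code → ℕ → V → List (Fin m) → V
  front c t x []       = x
  front c t x (a ∷ as) with rank a ℕ.<? t
  ... | yes _ = front c t (c a) as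
  ... | no  _ = x

  front-cong : ∀ {c c′ t t′} x L → (∀ {a} → a ∈ L → (rank a < t) ⇔ (rank a < t′)) →
               (∀ {a} → a ∈ L → rank a < t → c a ≡ c′ a) → front c t x L ≡ front c′ t′ x L
  front-cong x []       _    _     = refl
  front-cong {c} {c′} {t} {t′} x (a ∷ as) same agree with rank a ℕ.<? t | rank a ℕ.<? t′
  ... | yes a<t | yes _    = trans (cong (λ z → front c t z as) (agree (here refl) a<t))
                                   (front-cong (c′ a) as (same ∘ there) (agree ∘ there))
  ... | yes a<t | no  a≮t′ = contradiction (Equivalence.to (same (here refl)) a<t) a≮t′
  ... | no  a≮t | yes a<t′ = contradiction (Equivalence.from (same (here refl)) a<t′) a≮t
  ... | no  _   | no  _    = refl

  front-unprocessed : ∀ c t x L → (∀ {a} → a ∈ L → ¬ rank a < t) → front c t x L ≡ x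
  front-unprocessed c t x []       _          = refl
  front-unprocessed c t x (a ∷ as) unprocessed with rank a ℕ.<? t
  ... | yes a<t = contradiction a<t (unprocessed (here refl))
  ... | no  _   = refl

  front-processed : ∀ c t x a as → (∀ {a′} → a′ ∈ a ∷ as → rank a′ < t) →
                    front c t x (a ∷ as) ≡ c (lastArc G a as)
  front-processed c t x a as processed with rank a ℕ.<? t
  ... | no  a≮t = contradiction (processed (here refl)) a≮t
  ... | yes _ with as
  ...   | []      = refl
  ...   | a′ ∷ as′ = front-processed c t (c a) a′ as′ (processed ∘ there)

  front-updated : ∀ {u w L} → Walk G u w L → ∀ c t y x {b} → b ∈ L → rank b ≡ t →
                  front (updateAt c b (const y)) (suc t) x L ≡ y
  front-updated {L = b ∷ as} p c t y x (here refl) refl with rank b ℕ.<? suc t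
  ... | no  b≮1+t = contradiction ℕ.≤-refl b≮1+t
  ... | yes _     = trans (cong (λ z → front c′ (suc t) z as) (updateAt-updates b c))
                          (front-unprocessed c′ (suc t) y as λ a′∈ a′<1+t →
                             ℕ.<⇒≱ (rank-later p a′∈) (ℕ.s≤s⁻¹ a′<1+t))
    where c′ = updateAt c b (const y)
  front-updated {L = a ∷ as} (step _ p) c t y x (there b∈) refl with rank a ℕ.<? suc t
  ... | no  a≮1+t = contradiction (ℕ.m≤n⇒m≤1+n (rank-later (step refl p) b∈)) a≮1+t
  ... | yes _     = front-updated p c t y _ b∈ refl

  front-unaffected : ∀ c t y x {b} L → rank b ≡ t → b ∉ L →
                     front (updateAt c b (const y)) (suc t) x L ≡ front c t x L
  front-unaffected c t y x {b} L refl b∉L = front-cong x L same agree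
    where
    same : ∀ {a} → a ∈ L → (rank a < suc t) ⇔ (rank a < t)
    same a∈L = mk⇔ (λ a<1+t → ℕ.≤∧≢⇒< (ℕ.s≤s⁻¹ a<1+t) λ eq → b∉L (subst (_∈ L) (rank-injective eq) a∈L))
                   ℕ.m≤n⇒m≤1+n
    agree : ∀ {a} → a ∈ L → rank a < suc t → updateAt c b (const y) a ≡ c a
    agree {a} a∈L _ = updateAt-minimal a b c λ { refl → b∉L a∈L }

  front-before : ∀ {u w L} → Walk G u w L → Linked _≤_ (map f L) → ∀ c x {b} → b ∈ L →
                 (front c (rank b) x L ≡ x × tail G b ≡ u) ⊎
                 (∃ λ a → rank a < rank b × head G a ≡ tail G b × f a ≤ f b × front c (rank b) x L ≡ c a)
  front-before {L = b ∷ as} (step b←u _) _ c x (here refl) with rank b ℕ.<? rank b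
  ... | yes b<b = contradiction b<b (ℕ.<-irrefl refl)
  ... | no  _   = inj₁ (refl , b←u)
  front-before {L = a ∷ as} (step a←u p) linked c x {b} (there b∈) with rank a ℕ.<? rank b
  ... | no  a≮b = contradiction (rank-later (step a←u p) b∈) a≮b
  ... | yes a<b with front-before p (Linked-tail G f linked) c (c a) b∈
  ...   | inj₁ (eq , b←a) = inj₂ (a , a<b , sym b←a , Linked-head≤ G f linked (there b∈) , eq)
  ...   | inj₂ earlier    = inj₂ earlier

  g≤k : ∀ v → g v ≤ k
  g≤k = proj₁ fanExtension

  fanOf : ∀ v → v ≢ s → 0 < g v → Fan G f g (g v) v
  fanOf = proj₁ (proj₂ (proj₂ fanExtension))

  arcCondition : ∀ b → f b ≤ g (tail G b) ⊎ ∃ λ a → head G a ≡ tail G b × f a ≡ f b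
  arcCondition = proj₂ (proj₂ (proj₂ fanExtension))

  -- A fixed choice of fan per node (a proof of v ≢ s is not unique, so fanOf alone does not fix one).
  chosenFan : (v : Fin n) → Maybe (Fan G f g (g v) v)
  chosenFan v with v ≟ᶠ s | 0 ℕ.<? g v
  ... | no v≢s | yes 0<gv = just (fanOf v v≢s 0<gv)
  ... | _      | _        = nothing

  path : ∀ {i v} → Fan G f g i v → Fin i → List (Fin m)
  path fan j = Fan.first fan j ∷ Fan.rest fan j

  fronts : ∀ {v} → Code → ℕ → Fan G f g (g v) v → Vector V (g v)
  fronts c t fan j = front c t (unit (toℕ j)) (path fan j)

  FrontsBasis : Code → ℕ → (v : Fin n) → Maybe (Fan G f g (g v) v) → Set
  FrontsBasis c t v nothing    = ⊤
  FrontsBasis c t v (just fan) = IsBasisOf (HeightAtMost (g v)) (fronts c t fan)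

  FrontsBasis-map : ∀ {c c′ t t′ v} →
    (∀ fan → IsBasisOf (HeightAtMost (g v)) (fronts c t fan) → IsBasisOf (HeightAtMost (g v)) (fronts c′ t′ fan)) →
    ∀ mfan → FrontsBasis c t v mfan → FrontsBasis c′ t′ v mfan
  FrontsBasis-map _    nothing    _     = tt
  FrontsBasis-map keep (just fan) basis = keep fan basis

  FrontsBasis-chosen : ∀ {c t} v → v ≢ s → 0 < g v → FrontsBasis c t v (chosenFan v) →
                       Σ (Fan G f g (g v) v) λ fan → IsBasisOf (HeightAtMost (g v)) (fronts c t fan)
  FrontsBasis-chosen v v≢s 0<gv basis with v ≟ᶠ s | 0 ℕ.<? g v
  ... | yes v≡s  | _         = contradiction v≡s v≢s
  ... | no v≢s′  | yes 0<gv′ = fanOf v v≢s′ 0<gv′ , basis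
  ... | no _     | no 0≮gv   = contradiction 0<gv 0≮gv

  record Invariant (t : ℕ) (c : Code) : Set where
    field
      hasHeight   : ∀ a → rank a < t → HasHeight (f a) (c a)
      spanned     : ∀ a → rank a < t → tail G a ≢ s → SpannedAt c (tail G a) (c a)
      frontsBasis : ∀ v → FrontsBasis c t v (chosenFan v)

  initial : Invariant 0 (λ _ → 0ᵛ)
  initial = record
    { hasHeight   = λ _ ()
    ; spanned     = λ _ ()
    ; frontsBasis = λ v → standard (chosenFan v)
    }
    where
    standard : ∀ {v} mfan → FrontsBasis (λ _ → 0ᵛ) 0 v mfan
    standard nothing        = tt
    standard {v} (just fan) = IsBasisOf-cong (λ j → sym (front-unprocessed (λ _ → 0ᵛ) 0 _ (path fan j) (λ _ ())))
                                       (standardBasis (g≤k v))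

  idle : ∀ {t c} → Invariant t c → (∀ b → rank b ≢ t) → Invariant (suc t) c
  idle {t} {c} inv none = record
    { hasHeight   = λ a → hasHeight a ∘ earlier a
    ; spanned     = λ a → spanned a ∘ earlier a
    ; frontsBasis = λ v → FrontsBasis-map unchanged (chosenFan v) (frontsBasis v)
    }
    where
    open Invariant inv
    earlier : ∀ a → rank a < suc t → rank a < t
    earlier a a<1+t = ℕ.≤∧≢⇒< (ℕ.s≤s⁻¹ a<1+t) (none a)
    unchanged : ∀ {v} (fan : Fan G f g (g v) v) →
                IsBasisOf (HeightAtMost (g v)) (fronts c t fan) → IsBasisOf (HeightAtMost (g v)) (fronts c (suc t) fan)
    unchanged fan = IsBasisOf-cong λ j →
      front-cong _ (path fan j) (λ {a} _ → mk⇔ ℕ.m≤n⇒m≤1+n (earlier a)) (λ _ _ → refl)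

  module ProcessArc (b : Fin m) {c : Code} (inv : Invariant (rank b) c) where

    open Invariant inv

    x : Fin n
    x = tail G b

    c′ : V → Code
    c′ y = updateAt c b (const y)

    W : V → Set
    W y = HeightAtMost (f b) y × Available c x y

    W-isSubspace : IsSubspace W
    W-isSubspace = ×-isSubspace (HeightAtMost-isSubspace (f b)) (Available-isSubspace c x)

    c′-earlier : ∀ y {a} → rank a < rank b → c a ≡ c′ y a
    c′-earlier y {a} a<b = sym (updateAt-minimal a b c λ { refl → ℕ.<-irrefl refl a<b })

    unit-available : ∀ {u} → u < g x → Available c x (unit u)
    unit-available {u} u<gx with x ≟ᶠ s
    ... | yes x≡s = inj₁ x≡s
    ... | no  x≢s with FrontsBasis-chosen x x≢s (ℕ.≤-<-trans z≤n u<gx) (frontsBasis x)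
    ...   | fan , basis with IsBasisOf.spanning basis (unit u) (unit-HeightAtMost u<gx)
    ...     | μ , unit≗ = inj₂ (IsSubspace.≗-closed (SpannedAt-isSubspace c x) (sym ∘ unit≗)
                            (lincomb-closed (SpannedAt-isSubspace c x) μ _ front-spanned))
      where
      front-spanned : ∀ j → SpannedAt c x (fronts c (rank b) fan j)
      front-spanned j = subst (SpannedAt c x)
        (sym (front-processed c _ _ _ _ (rank-before-end (Fan.isPath fan j))))
        (SpannedAt-entering c _ (lastArc-head G (Fan.isPath fan j)))

    front-∈W : ∀ {v} (fan : Fan G f g (g v) v) j → b ∈ path fan j → W (fronts c (rank b) fan j)
    front-∈W fan j b∈path with front-before (Fan.isPath fan j) (Fan.monotone fan j) c (unit (toℕ j)) b∈path
    ... | inj₁ (eq , b←start) = subst W (sym eq) (unit-HeightAtMost j<fb , unit-available j<gx)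
      where
      j<first = Fan.lowerB fan j
      j<fb  = ℕ.<-≤-trans j<first (Linked-head≤ G f (Fan.monotone fan j) b∈path)
      j<gx  = ℕ.<-≤-trans j<first (subst (λ v → f (Fan.first fan j) ≤ g v) (sym b←start) (Fan.startOK fan j))
    ... | inj₂ (a , a<b , a→x , fa≤fb , eq) =
      subst W (sym eq) (HeightAtMost-mono fa≤fb (proj₁ (hasHeight a a<b)) , inj₂ (SpannedAt-entering c a a→x))

    TopNonzero : V → Set
    TopNonzero y = ∀ l → suc (toℕ l) ≡ f b → y l ≢ 0#

    heightRequirement : Requirement W 1 TopNonzero
    heightRequirement = by-height (f b) refl
      where
      by-height : ∀ h → f b ≡ h → Requirement W 1 TopNonzero
      by-height zero    fb≡0   = trivialRequirement λ _ l 1+l≡fb → contradiction (trans 1+l≡fb fb≡0) ℕ.1+n≢0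
      by-height (suc h) fb≡1+h = singleRequirement φ λ {y} _ y[top]≢0 l 1+l≡fb →
        subst (λ l → y l ≢ 0#) (Fin.toℕ-injective (trans top-h (ℕ.suc-injective (sym (trans 1+l≡fb fb≡1+h))))) y[top]≢0
        where
        h<k : h < k
        h<k = subst (_≤ k) fb≡1+h (f≤k b)
        top = fromℕ< h<k
        top-h : toℕ top ≡ h
        top-h = Fin.toℕ-fromℕ< h<k
        h<fb : h < f b
        h<fb = subst (h <_) (sym fb≡1+h) ℕ.≤-refl
        witness : Σ V λ w → W w × w top ≢ 0#
        witness with arcCondition b
        ... | inj₁ fb≤gx = unit h , (unit-HeightAtMost h<fb , unit-available (ℕ.<-≤-trans h<fb fb≤gx)) ,
                           λ eq → 0≢1 (trans (sym eq) (unit-≡ top-h))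
        ... | inj₂ (a , a→x , fa≡fb) = c a ,
          (subst (λ h′ → HeightAtMost h′ (c a)) fa≡fb (proj₁ a-height) , inj₂ (SpannedAt-entering c a a→x)) ,
          proj₂ a-height top (trans (cong suc top-h) (trans (sym fb≡1+h) (sym fa≡fb)))
          where a-height = hasHeight a (rank-arc a→x)
        φ : NonzeroFormOn W
        φ = record { form = λ y → y top ; +·-linear = λ _ _ _ → refl
                   ; witness = proj₁ witness ; witness∈W = proj₁ (proj₂ witness) ; witness≢0 = proj₂ (proj₂ witness) }

    exchangeRequirement : ∀ {v} (fan : Fan G f g (g v) v) → IsBasisOf (HeightAtMost (g v)) (fronts c (rank b) fan) →
      ∀ j → b ∈ path fan j → Requirement W 1 (λ y → IsBasisOf (HeightAtMost (g v)) (fronts (c′ y) (suc (rank b)) fan))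
    exchangeRequirement {v} fan basis j b∈path = singleRequirement φ sufficient
      where
      open Coordinates basis
      W⊆ : ∀ {y} → W y → HeightAtMost (g v) y
      W⊆ (y≤fb , _) = HeightAtMost-mono
        (ℕ.≤-trans (Linked-≤last G f (Fan.monotone fan j) b∈path) (Fan.upperB fan j)) y≤fb
      φ : NonzeroFormOn W
      φ = record
        { form      = λ y → coord y j
        ; +·-linear = λ r y₁∈ y₂∈ → coord-+· r (W⊆ y₁∈) (W⊆ y₂∈) j
        ; witness   = fronts c (rank b) fan j
        ; witness∈W = front-∈W fan j b∈path
        ; witness≢0 = λ eq → 0≢1 (trans (sym eq) (coord-basisVector j))
        }
      sufficient : ∀ {y} → W y → coord y j ≢ 0# → IsBasisOf (HeightAtMost (g v)) (fronts (c′ y) (suc (rank b)) fan)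
      sufficient {y} y∈W y[j]≢0 = IsBasisOf-cong exchanged
        (IsBasisOf-exchange j (coord y) basis (W⊆ y∈W) (coord-spec (W⊆ y∈W)) y[j]≢0)
        where
        exchanged : ∀ j′ → updateAt (fronts c (rank b) fan) j (const y) j′ ≡ fronts (c′ y) (suc (rank b)) fan j′
        exchanged j′ with j′ ≟ᶠ j
        ... | yes refl = trans (updateAt-updates j _) (sym (front-updated (Fan.isPath fan j) c _ y _ b∈path refl))
        ... | no  j′≢j = trans (updateAt-minimal j′ j _ j′≢j)
          (sym (front-unaffected c _ y _ (path fan j′) refl λ b∈′ →
                  Fan.disjoint fan j j′ (j′≢j ∘ sym) b b∈path b∈′))

    FrontsUpdated : Fin n → V → Set
    FrontsUpdated v y = FrontsBasis (c′ y) (suc (rank b)) v (chosenFan v)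

    fanRequirement : ∀ v → Requirement W 1 (FrontsUpdated v)
    fanRequirement v = by-fan (chosenFan v) (frontsBasis v)
      where
      by-fan : ∀ mfan → FrontsBasis c (rank b) v mfan → Requirement W 1 (λ y → FrontsBasis (c′ y) (suc (rank b)) v mfan)
      by-fan nothing    _     = trivialRequirement λ _ → tt
      by-fan (just fan) basis with Fin.any? (λ j → b ∈? path fan j)
      ... | yes (j , b∈path) = exchangeRequirement fan basis j b∈path
      ... | no  b∉paths      = trivialRequirement λ {y} _ → IsBasisOf-cong
        (λ j → sym (front-unaffected c _ y _ (path fan j) refl (λ b∈ → b∉paths (j , b∈)))) basis

    extend : ∀ {y} → W y → TopNonzero y → (∀ v → FrontsUpdated v y) → Invariant (suc (rank b)) (c′ y)
    extend {y} (y≤fb , y-available) y-top fronts-ok = record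
      { hasHeight = hasHeight′ ; spanned = spanned′ ; frontsBasis = fronts-ok }
      where
      earlier : ∀ {a} → rank a < suc (rank b) → a ≢ b → rank a < rank b
      earlier a<1+b a≢b = ℕ.≤∧≢⇒< (ℕ.s≤s⁻¹ a<1+b) (a≢b ∘ rank-injective)

      stable : ∀ {a z} → rank a < rank b → SpannedAt c (tail G a) z → SpannedAt (c′ y) (tail G a) z
      stable a<b = SpannedAt-local λ a′ a′→a → c′-earlier y (ℕ.<-trans (rank-arc a′→a) a<b)

      hasHeight′ : ∀ a → rank a < suc (rank b) → HasHeight (f a) (c′ y a)
      hasHeight′ a a<1+b with a ≟ᶠ b
      ... | yes refl = subst (HasHeight (f b)) (sym (updateAt-updates b c)) (y≤fb , y-top)
      ... | no  a≢b  = subst (HasHeight (f a)) (sym (updateAt-minimal a b c a≢b)) (hasHeight a (earlier a<1+b a≢b))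

      spanned′ : ∀ a → rank a < suc (rank b) → tail G a ≢ s → SpannedAt (c′ y) (tail G a) (c′ y a)
      spanned′ a a<1+b a↚s with a ≟ᶠ b
      ... | yes refl = subst (SpannedAt (c′ y) x) (sym (updateAt-updates b c))
                         (SpannedAt-local (λ a′ a′→x → c′-earlier y (rank-arc a′→x))
                           (fromInj₂ (λ x≡s → contradiction x≡s a↚s) y-available))
      ... | no  a≢b  = subst (SpannedAt (c′ y) (tail G a)) (sym (updateAt-minimal a b c a≢b))
                         (stable (earlier a<1+b a≢b) (spanned a (earlier a<1+b a≢b) a↚s))

    process : suc n < size → ∃ λ y → Invariant (suc (rank b)) (c′ y)
    process big with Requirement-satisfiable W-isSubspace (×-Requirement heightRequirement (Π-Requirement fanRequirement))
                    (subst (λ N → suc N < size) (sym (ℕ.*-identityʳ n)) big)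
    ... | y , y∈W , y-top , fronts-ok = y , extend y∈W y-top fronts-ok

  run : suc n < size → ∀ t → ∃ λ c → Invariant t c
  run big zero = _ , initial
  run big (suc t) with run big t | Fin.any? (λ b → rank b ℕ.≟ t)
  ... | c , inv | yes (b , refl) = _ , proj₂ (ProcessArc.process b inv big)
  ... | c , inv | no  none       = c , idle inv (λ b eq → none (b , eq))

mainTheorem5 : ∀ {n m : ℕ} (G : Digraph n m) (s : Fin n) (k : ℕ) (f : Fin m → ℕ) →
    Acyclic G → SingleSource G s → AllReachable G s →
    (∀ a → f a ≤ k) →
    HasFanExtension G s k f →
    IsHeightFunction G s k f
mainTheorem5 {n} {m} G s k f acyclic _ _ f≤k (g , fanExtension) with ∃-finiteField> (suc n)
... | F , big with run big (suc n ℕ.* m)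
  where open GreedyCode G s k f g acyclic f≤k fanExtension F using (run)
... | c , invariant = F , c , (λ b b↚s → spanned b (rank<bound b) b↚s) ,
                      λ a → height-HasHeight (c a) (f≤k a) (hasHeight a (rank<bound a))
  where
  open FieldProperties F using (height-HasHeight)
  open ArcRank G acyclic using (rank<bound)
  open GreedyCode.Invariant invariant
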